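{- There are exactly 56 $(M_c,\Lambda_c)$-clonoids, and they are exactly the sets $K^{\mathrm d}=\{f^{\mathrm d}: f\in K\}$ where $K$ ranges over the $(M_c,V_c)$-clonoids.
   Context: A Boolean function is $f\colon\{0,1\}^n\to\{0,1\}$, $n\ge1$; $\Omega$ is the set of all of them. For sets $I,J$ of Boolean functions, $IJ:=\{f(g_1,\dots,g_n): f\in I\ n\text{ -ary},\ g_i\in J \text{ all } m\text{ -ary}\}$. A clone is a set of Boolean functions containing all projections and closed under composition. For clones $C_1,C_2$, a $(C_1,C_2)$-clonoid is $K\subseteq\Omega$ with $KC_1\subseteq K$ and $C_2K\subseteq K$. $M_c$ is the clone of monotone $f$ with $f(0,\dots,0)=0$, $f(1,\dots,1)=1$; $V_c$ is the clone generated by binary $\vee$, $\Lambda_c$ the clone generated by binary $\wedge$. The dual of $f$ is $f^{\mathrm d}(x_1,\dots,x_n)=\neg f(\neg x_1,\dots,\neg x_n)$. -}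

module Defs where

open import Level using (0ℓ)
open import Data.Nat using (ℕ; zero; suc)
open import Data.Bool using (Bool; true; false; if_then_else_; not; _∨_; _∧_) renaming (_≤_ to _≤ᵇ_)
open import Data.Fin using (Fin; zero; suc)
open import Data.Vec using (Vec; []; _∷_; lookup; tabulate; map; replicate)
open import Data.Vec.Relation.Binary.Pointwise.Inductive using (Pointwise)
open import Data.Product using (Σ; _×_; _,_; ∃)
open import Relation.Binary.PropositionalEquality using (_≡_)
open import Relation.Unary using (Pred; _⊆_)

-- Truth-table (Shannon tree) representation of an n-ary Boolean function.
-- BF (suc n) = (f restricted to x₀ = false , f restricted to x₀ = true).
-- Propositional equality on BF n coincides with extensional equality.
BF : ℕ → Set
BF zero = Bool
BF (suc n) = BF n × BF n

eval : ∀ {n} → BF n → Vec Bool n → Bool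
eval {zero} b [] = b
eval {suc n} (f₀ , f₁) (x ∷ xs) = if x then eval f₁ xs else eval f₀ xs

tab : ∀ {n} → (Vec Bool n → Bool) → BF n
tab {zero} f = f []
tab {suc n} f = tab (λ xs → f (false ∷ xs)) , tab (λ xs → f (true ∷ xs))

-- Ω : all Boolean functions of arity ≥ 1; (n , f) has arity suc n.
Ω : Set
Ω = Σ ℕ (λ n → BF (suc n))

SetΩ : Set₁
SetΩ = Pred Ω 0ℓ

compose : ∀ {n m} → BF (suc n) → (Fin (suc n) → BF (suc m)) → BF (suc m)
compose f gs = tab (λ x → eval f (tabulate (λ i → eval (gs i) x)))

_·_ : SetΩ → SetΩ → SetΩ
(I · J) h = Σ ℕ λ n → Σ ℕ λ m → Σ (BF (suc n)) λ f → Σ (Fin (suc n) → BF (suc m)) λ gs →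
  I (n , f) × (∀ i → J (m , gs i)) × (h ≡ (m , compose f gs))

projection : ∀ n → Fin (suc n) → BF (suc n)
projection n i = tab (λ x → lookup x i)

IsClonoid : SetΩ → SetΩ → SetΩ → Set
IsClonoid C₁ C₂ K = ((K · C₁) ⊆ K) × ((C₂ · K) ⊆ K)

data ⟨_⟩ (F : SetΩ) : SetΩ where
  gen  : ∀ {h} → F h → ⟨ F ⟩ h
  proj : ∀ n (i : Fin (suc n)) → ⟨ F ⟩ (n , projection n i)
  comp : ∀ {n m} (f : BF (suc n)) (gs : Fin (suc n) → BF (suc m)) →
         ⟨ F ⟩ (n , f) → (∀ i → ⟨ F ⟩ (m , gs i)) → ⟨ F ⟩ (m , compose f gs)

Mc : SetΩ
Mc (n , f) = (∀ x y → Pointwise _≤ᵇ_ x y → eval f x ≤ᵇ eval f y)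
           × (eval f (replicate _ false) ≡ false)
           × (eval f (replicate _ true) ≡ true)

or₂ and₂ : BF 2
or₂  = tab (λ x → lookup x zero ∨ lookup x (suc zero))
and₂ = tab (λ x → lookup x zero ∧ lookup x (suc zero))

Vc : SetΩ
Vc = ⟨ (λ h → h ≡ (1 , or₂)) ⟩

Λc : SetΩ
Λc = ⟨ (λ h → h ≡ (1 , and₂)) ⟩

dual : Ω → Ω
dual (n , f) = n , tab (λ x → not (eval f (map not x)))

dualSet : SetΩ → SetΩ
dualSet K h = Σ Ω λ f → K f × (h ≡ dual f)

{-# OPTIONS --safe #-}
-- Sort the members h of an (M_c, Λ_c)-clonoid K by their type (h 0, h 1). Right composition
-- with M_c is precomposition with monotone maps fixing 0 and 1, so what matters about h is how
-- often it alternates along chains from 0 to 1: if h alternates k + 1 times, K contains the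
-- parity function of arity k + 1 of its type, and that parity function yields every function
-- whose alternations are counted by a monotone rank. With closure under ∧, the parity function
-- with the most alternations a type can need generates the whole type (every function is a
-- conjunction of functions that vanish at a single point); below it only the constant,
-- increasing, decreasing or convex functions of the type can occur. So each type carries a
-- level in a chain of length 4, 3, 3 or 3, and conjunctions across types rule out all but 56
-- combinations. The second statement is duality: f ↦ f^d fixes M_c and exchanges ∧ and ∨.
module Submission where

open import Defs
open import Data.Bool using (Bool; true; false; not; _∧_; _∨_; T; if_then_else_)
  renaming (_≤_ to _≤ᵇ_)
open import Data.Bool.Base using (b≤b; f≤t)
open import Data.Bool.Properties
  using (not-involutive; ∧-comm; ∧-idem; ∨-zeroʳ; if-eta; T?)
  renaming (_≟_ to _≟ᵇ_; _≤?_ to _≤ᵇ?_; ≤-refl to ≤ᵇ-refl; ≤-trans to ≤ᵇ-trans; ≤-antisym to ≤ᵇ-antisym;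
            ≤-minimum to ≤ᵇ-minimum; ≤-maximum to ≤ᵇ-maximum)
open import Data.Empty using (⊥; ⊥-elim)
open import Data.Fin using (Fin; zero; suc; toℕ; fromℕ<; inject₁; _≟_) renaming (_≤_ to _≤ᶠ_)
open import Data.Fin.Properties using (toℕ-fromℕ<; all?) renaming (≤-antisym to ≤ᶠ-antisym)
open import Data.List using (List; []; _∷_; length; allFin; cartesianProduct; filter)
open import Data.List.Membership.Propositional.Properties
  using (∈-allFin; ∈-cartesianProduct⁺; ∈-filter⁺; ∈-filter⁻)
open import Data.List.Relation.Unary.Linked using (Linked; [-]; _∷_)
open import Data.Nat using (ℕ; zero; suc; _+_; _≤_; z≤n; s≤s)
import Data.Nat.Properties as ℕ
open import Data.Product using (Σ; _×_; _,_; proj₁; proj₂; ∃)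
open import Data.Product.Properties using () renaming (≡-dec to ×-≡-dec)
open import Data.Unit using (⊤; tt)
open import Data.Vec using (Vec; []; _∷_; head; lookup; tabulate; map; replicate; fromList)
open import Data.Vec.Membership.Propositional using (_∈_)
open import Data.Vec.Membership.Propositional.Properties using (∈-fromList⁺; ∈-fromList⁻; ∈-lookup)
open import Data.Vec.Properties
  using (≡-dec; tabulate-cong; tabulate∘lookup; lookup∘tabulate; lookup-replicate; lookup-map;
         map-replicate; map-∘; map-cong; map-id; tabulate-∘)
open import Data.Vec.Relation.Binary.Pointwise.Inductive as PW using (Pointwise; []; _∷_)
open import Data.Vec.Relation.Unary.AllPairs using (allPairs?)
open import Data.Vec.Relation.Unary.Any using (index)
open import Data.Vec.Relation.Unary.Any.Properties using (lookup-index)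
open import Data.Vec.Relation.Unary.Unique.Propositional using (Unique)
open import Data.Vec.Relation.Unary.Unique.Propositional.Properties using (lookup-injective)
open import Function using (_∘_)
open import Function.Bundles using (_⇔_; mk⇔)
open import Relation.Binary.Definitions using (DecidableEquality)
open import Relation.Binary.PropositionalEquality
  using (_≡_; _≢_; refl; sym; trans; cong; cong₂; subst; subst₂; _≗_; module ≡-Reasoning)
open import Relation.Nullary using (¬_; Dec; yes; no; does; ¬?; _×-dec_)
open import Relation.Nullary.Decidable
  using (True; toWitness; from-yes; dec-true; dec-false; ¬¬-excluded-middle)
open import Relation.Nullary.Negation using (¬¬-map)
open import Relation.Unary using (Decidable; _⊆_; _≐_)

eval-tab : ∀ {n} (f : Vec Bool n → Bool) → eval (tab f) ≗ f
eval-tab {zero}  f []          = refl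
eval-tab {suc n} f (false ∷ x) = eval-tab (f ∘ (false ∷_)) x
eval-tab {suc n} f (true  ∷ x) = eval-tab (f ∘ (true ∷_)) x

tab-cong : ∀ {n} {f g : Vec Bool n → Bool} → f ≗ g → tab f ≡ tab g
tab-cong {zero}  f≗g = f≗g []
tab-cong {suc n} f≗g = cong₂ _,_ (tab-cong (f≗g ∘ (false ∷_))) (tab-cong (f≗g ∘ (true ∷_)))

tab-eval : ∀ {n} (f : BF n) → tab (eval f) ≡ f
tab-eval {zero}  b         = refl
tab-eval {suc n} (f₀ , f₁) = cong₂ _,_ (tab-eval f₀) (tab-eval f₁)

eval-injective : ∀ {n} {f g : BF n} → eval f ≗ eval g → f ≡ g
eval-injective {f = f} {g} f≗g = trans (sym (tab-eval f)) (trans (tab-cong f≗g) (tab-eval g))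

eval-compose : ∀ {n m} (f : BF (suc n)) (gs : Fin (suc n) → BF (suc m)) →
               eval (compose f gs) ≗ λ x → eval f (tabulate (λ i → eval (gs i) x))
eval-compose f gs = eval-tab _

∈-tab : ∀ (K : SetΩ) {n} {f : BF (suc n)} {F : Vec Bool (suc n) → Bool} →
        K (n , f) → eval f ≗ F → K (n , tab F)
∈-tab K {n} {f} f∈K f≗F = subst (λ g → K (n , g)) (trans (sym (tab-eval f)) (tab-cong f≗F)) f∈K

∈-≗ : ∀ (K : SetΩ) {n} {f g : BF (suc n)} → K (n , f) → eval f ≗ eval g → K (n , g)
∈-≗ K {n} f∈K f≗g = subst (λ h → K (n , h)) (eval-injective f≗g) f∈K

compose-projection : ∀ {n m} (i : Fin (suc n)) (gs : Fin (suc n) → BF (suc m)) →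
                     compose (projection n i) gs ≡ gs i
compose-projection i gs = eval-injective λ x →
  trans (eval-compose (projection _ i) gs x)
        (trans (eval-tab (λ v → lookup v i) _) (lookup∘tabulate (λ j → eval (gs j) x) i))

compose-assoc : ∀ {n k m} (f : BF (suc n)) (gs : Fin (suc n) → BF (suc k)) (hs : Fin (suc k) → BF (suc m)) →
                compose (compose f gs) hs ≡ compose f (λ i → compose (gs i) hs)
compose-assoc f gs hs = eval-injective λ x → let y = tabulate (λ j → eval (hs j) x) in begin
  eval (compose (compose f gs) hs) x
    ≡⟨ eval-compose (compose f gs) hs x ⟩
  eval (compose f gs) y
    ≡⟨ eval-compose f gs y ⟩
  eval f (tabulate (λ i → eval (gs i) y))
    ≡⟨ cong (eval f) (tabulate-cong λ i → sym (eval-compose (gs i) hs x)) ⟩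
  eval f (tabulate (λ i → eval (compose (gs i) hs) x))
    ≡⟨ sym (eval-compose f (λ i → compose (gs i) hs) x) ⟩
  eval (compose f (λ i → compose (gs i) hs)) x
    ∎
  where open ≡-Reasoning

compose-cong : ∀ {n m} (f : BF (suc n)) {gs hs : Fin (suc n) → BF (suc m)} → (∀ i → gs i ≡ hs i) →
               compose f gs ≡ compose f hs
compose-cong f gs≡hs = tab-cong λ x → cong (eval f) (tabulate-cong λ i → cong (λ g → eval g x) (gs≡hs i))

_≤ⱽ_ : ∀ {n} → Vec Bool n → Vec Bool n → Set
_≤ⱽ_ = Pointwise _≤ᵇ_

0ⱽ 1ⱽ : ∀ {n} → Vec Bool n
0ⱽ = replicate _ false
1ⱽ = replicate _ true

≤ⱽ-refl : ∀ {n} {x : Vec Bool n} → x ≤ⱽ x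
≤ⱽ-refl = PW.refl ≤ᵇ-refl

≤ⱽ-trans : ∀ {n} {x y z : Vec Bool n} → x ≤ⱽ y → y ≤ⱽ z → x ≤ⱽ z
≤ⱽ-trans = PW.trans ≤ᵇ-trans

≤ⱽ-antisym : ∀ {n} {x y : Vec Bool n} → x ≤ⱽ y → y ≤ⱽ x → x ≡ y
≤ⱽ-antisym []       []       = refl
≤ⱽ-antisym (p ∷ ps) (q ∷ qs) = cong₂ _∷_ (≤ᵇ-antisym p q) (≤ⱽ-antisym ps qs)

0ⱽ-minimum : ∀ {n} (x : Vec Bool n) → 0ⱽ ≤ⱽ x
0ⱽ-minimum []      = []
0ⱽ-minimum (b ∷ x) = ≤ᵇ-minimum b ∷ 0ⱽ-minimum x

1ⱽ-maximum : ∀ {n} (x : Vec Bool n) → x ≤ⱽ 1ⱽ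
1ⱽ-maximum []      = []
1ⱽ-maximum (b ∷ x) = ≤ᵇ-maximum b ∷ 1ⱽ-maximum x

0ⱽ≢1ⱽ : ∀ {n} → 0ⱽ {suc n} ≢ 1ⱽ
0ⱽ≢1ⱽ ()

≤0ⱽ⇒≡0ⱽ : ∀ {n} {x : Vec Bool n} → x ≤ⱽ 0ⱽ → x ≡ 0ⱽ
≤0ⱽ⇒≡0ⱽ {x = x} x≤0 = ≤ⱽ-antisym x≤0 (0ⱽ-minimum x)

1ⱽ≤⇒≡1ⱽ : ∀ {n} {x : Vec Bool n} → 1ⱽ ≤ⱽ x → x ≡ 1ⱽ
1ⱽ≤⇒≡1ⱽ {x = x} 1≤x = ≤ⱽ-antisym (1ⱽ-maximum x) 1≤x

_≤?ⱽ_ : ∀ {n} (x y : Vec Bool n) → Dec (x ≤ⱽ y)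
_≤?ⱽ_ = PW.decidable _≤ᵇ?_

_≟ⱽ_ : ∀ {n} (x y : Vec Bool n) → Dec (x ≡ y)
_≟ⱽ_ = ≡-dec _≟ᵇ_

does⇒ : ∀ {P : Set} (P? : Dec P) → does P? ≡ true → P
does⇒ (yes p) _ = p

tabulate-constant : ∀ {n} {b : Bool} {f : Fin n → Bool} → (∀ i → f i ≡ b) → tabulate f ≡ replicate n b
tabulate-constant {zero}  f≡b = refl
tabulate-constant {suc n} f≡b = cong₂ _∷_ (f≡b zero) (tabulate-constant (f≡b ∘ suc))

replicate-mono : ∀ n {a b} → a ≤ᵇ b → replicate n a ≤ⱽ replicate n b
replicate-mono zero    a≤b = []
replicate-mono (suc n) a≤b = a≤b ∷ replicate-mono n a≤b

chain-mono : ∀ {n} (c : ℕ → Vec Bool n) → (∀ j → c j ≤ⱽ c (suc j)) → ∀ {i j} → i ≤ j → c i ≤ⱽ c j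
chain-mono c step {zero}  {zero}  _         = ≤ⱽ-refl
chain-mono c step {zero}  {suc j} _         = ≤ⱽ-trans (chain-mono c step {zero} {j} z≤n) (step j)
chain-mono c step         (s≤s i≤j) = chain-mono (c ∘ suc) (step ∘ suc) i≤j

Monotone : ∀ {m n} → (Vec Bool m → Vec Bool n) → Set
Monotone φ = ∀ {x y} → x ≤ⱽ y → φ x ≤ⱽ φ y

Increasing : ∀ {n} → (Vec Bool n → Bool) → Set
Increasing F = ∀ {x y} → x ≤ⱽ y → F x ≡ true → F y ≡ true

Decreasing : ∀ {n} → (Vec Bool n → Bool) → Set
Decreasing F = ∀ {x y} → x ≤ⱽ y → F y ≡ true → F x ≡ true

Convex : ∀ {n} → (Vec Bool n → Bool) → Set
Convex F = ∀ {x y z} → x ≤ⱽ y → y ≤ⱽ z → F x ≡ true → F z ≡ true → F y ≡ true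

Constant : Bool → ∀ {n} → (Vec Bool n → Bool) → Set
Constant b F = ∀ x → F x ≡ b

_∧ᶠ_ : ∀ {n} → (Vec Bool n → Bool) → (Vec Bool n → Bool) → Vec Bool n → Bool
(F ∧ᶠ G) u = F u ∧ G u

∧ᶠ-comm : ∀ {n} (F G : Vec Bool n → Bool) → F ∧ᶠ G ≗ G ∧ᶠ F
∧ᶠ-comm F G x = ∧-comm (F x) (G x)

implies⇒≤ᵇ : ∀ {a b} → (a ≡ true → b ≡ true) → a ≤ᵇ b
implies⇒≤ᵇ {false} _   = ≤ᵇ-minimum _
implies⇒≤ᵇ {true}  a⇒b = subst (true ≤ᵇ_) (sym (a⇒b refl)) ≤ᵇ-refl

≤ᵇ⇒implies : ∀ {a b} → a ≤ᵇ b → a ≡ true → b ≡ true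
≤ᵇ⇒implies b≤b a≡true = a≡true
≤ᵇ⇒implies f≤t _      = refl

∧-intro : ∀ {a b} → a ≡ true → b ≡ true → a ∧ b ≡ true
∧-intro refl refl = refl

∧-elimˡ : ∀ {a b} → a ∧ b ≡ true → a ≡ true
∧-elimˡ {true} _ = refl

∧-elimʳ : ∀ {a b} → a ∧ b ≡ true → b ≡ true
∧-elimʳ {true} b≡true = b≡true

∀ᵇ ∃ᵇ : ∀ {n} → (Vec Bool n → Bool) → Bool
∀ᵇ {zero}  p = p []
∀ᵇ {suc n} p = ∀ᵇ (p ∘ (false ∷_)) ∧ ∀ᵇ (p ∘ (true ∷_))
∃ᵇ {zero}  p = p []
∃ᵇ {suc n} p = ∃ᵇ (p ∘ (false ∷_)) ∨ ∃ᵇ (p ∘ (true ∷_))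

∀ᵇ-intro : ∀ {n} (p : Vec Bool n → Bool) → (∀ x → p x ≡ true) → ∀ᵇ p ≡ true
∀ᵇ-intro {zero}  p all = all []
∀ᵇ-intro {suc n} p all = ∧-intro (∀ᵇ-intro _ (all ∘ (false ∷_))) (∀ᵇ-intro _ (all ∘ (true ∷_)))

∀ᵇ-elim : ∀ {n} (p : Vec Bool n → Bool) → ∀ᵇ p ≡ true → ∀ x → p x ≡ true
∀ᵇ-elim {zero}  p all []          = all
∀ᵇ-elim {suc n} p all (false ∷ x) = ∀ᵇ-elim _ (∧-elimˡ all) x
∀ᵇ-elim {suc n} p all (true  ∷ x) = ∀ᵇ-elim _ (∧-elimʳ {∀ᵇ (p ∘ (false ∷_))} all) x

∃ᵇ-intro : ∀ {n} (p : Vec Bool n → Bool) x → p x ≡ true → ∃ᵇ p ≡ true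
∃ᵇ-intro {zero}  p []          px = px
∃ᵇ-intro {suc n} p (false ∷ x) px = cong (_∨ ∃ᵇ (p ∘ (true ∷_))) (∃ᵇ-intro (p ∘ (false ∷_)) x px)
∃ᵇ-intro {suc n} p (true  ∷ x) px =
  trans (cong (∃ᵇ (p ∘ (false ∷_)) ∨_) (∃ᵇ-intro (p ∘ (true ∷_)) x px)) (∨-zeroʳ _)

∃ᵇ-elim : ∀ {n} (p : Vec Bool n → Bool) → ∃ᵇ p ≡ true → ∃ λ x → p x ≡ true
∃ᵇ-elim {zero}  p some = [] , some
∃ᵇ-elim {suc n} p some with ∃ᵇ (p ∘ (false ∷_)) in some₀
... | true  = let x , px = ∃ᵇ-elim _ some₀ in false ∷ x , px
... | false = let x , px = ∃ᵇ-elim _ some  in true  ∷ x , px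

∀ᵇ-const : ∀ {n} (c : Bool) → ∀ᵇ {n} (λ _ → c) ≡ c
∀ᵇ-const {zero}  c = refl
∀ᵇ-const {suc n} c = trans (cong₂ _∧_ (∀ᵇ-const {n} c) (∀ᵇ-const {n} c)) (∧-idem c)

∀ᵇ-false : ∀ {n} (p : Vec Bool n → Bool) x → p x ≡ false → ∀ᵇ p ≡ false
∀ᵇ-false p x px with ∀ᵇ p in all
... | false = refl
... | true  with () ← trans (sym px) (∀ᵇ-elim p all x)

∃ᵇ-false : ∀ {n} (p : Vec Bool n → Bool) → ∃ᵇ p ≡ false → ∀ x → p x ≡ false
∃ᵇ-false p none x with p x in px
... | false = refl
... | true  with () ← trans (sym (∃ᵇ-intro p x px)) none

-- Parity functions and chains

bit : Bool → ℕ
bit false = 0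
bit true  = 1

weight : ∀ {n} → Vec Bool n → ℕ
weight []      = 0
weight (b ∷ x) = bit b + weight x

flips : ℕ → Bool → Bool
flips zero    a = a
flips (suc k) a = not (flips k a)

parity : Bool → ∀ k → BF (suc k)
parity a k = tab (λ x → flips (weight x) a)

bit-mono : ∀ {a b} → a ≤ᵇ b → bit a ≤ bit b
bit-mono b≤b = ℕ.≤-refl
bit-mono f≤t = z≤n

weight-mono : ∀ {n} {x y : Vec Bool n} → x ≤ⱽ y → weight x ≤ weight y
weight-mono []       = z≤n
weight-mono (p ∷ ps) = ℕ.+-mono-≤ (bit-mono p) (weight-mono ps)

weight-0ⱽ : ∀ n → weight (0ⱽ {n}) ≡ 0
weight-0ⱽ zero    = refl
weight-0ⱽ (suc n) = weight-0ⱽ n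

weight-1ⱽ : ∀ n → weight (1ⱽ {n}) ≡ n
weight-1ⱽ zero    = refl
weight-1ⱽ (suc n) = cong suc (weight-1ⱽ n)

weight-≤ : ∀ {n} (x : Vec Bool n) → weight x ≤ n
weight-≤ []          = z≤n
weight-≤ (false ∷ x) = ℕ.m≤n⇒m≤1+n (weight-≤ x)
weight-≤ (true  ∷ x) = s≤s (weight-≤ x)

bit-increasing : ∀ {n} {G : Vec Bool n → Bool} → Increasing G → ∀ {x y} → x ≤ⱽ y → bit (G x) ≤ bit (G y)
bit-increasing inc x≤y = bit-mono (implies⇒≤ᵇ (inc x≤y))

stdChain : ∀ k → ℕ → Vec Bool k
stdChain zero    j       = []
stdChain (suc k) zero    = 0ⱽ
stdChain (suc k) (suc j) = true ∷ stdChain k j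

stdChain-mono : ∀ k {i j} → i ≤ j → stdChain k i ≤ⱽ stdChain k j
stdChain-mono zero    _         = []
stdChain-mono (suc k) {zero} _  = 0ⱽ-minimum _
stdChain-mono (suc k) (s≤s i≤j) = ≤ᵇ-refl ∷ stdChain-mono k i≤j

stdChain-0 : ∀ k → stdChain k 0 ≡ 0ⱽ
stdChain-0 zero    = refl
stdChain-0 (suc k) = refl

stdChain-top : ∀ k → stdChain k k ≡ 1ⱽ
stdChain-top zero    = refl
stdChain-top (suc k) = cong (true ∷_) (stdChain-top k)

weight-stdChain : ∀ k {j} → j ≤ k → weight (stdChain k j) ≡ j
weight-stdChain zero    z≤n       = refl
weight-stdChain (suc k) {zero} _  = weight-0ⱽ k
weight-stdChain (suc k) (s≤s j≤k) = cong suc (weight-stdChain k j≤k)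

through : ∀ {n} → List (Vec Bool n) → ℕ → Vec Bool n
through xs       zero          = 0ⱽ
through []       (suc j)       = 1ⱽ
through (x ∷ xs) (suc zero)    = x
through (x ∷ xs) (suc (suc j)) = through xs (suc j)

through-step : ∀ {n} {xs : List (Vec Bool n)} → Linked _≤ⱽ_ xs → ∀ j → through xs j ≤ⱽ through xs (suc j)
through-step                      _         zero          = 0ⱽ-minimum _
through-step {xs = []}            _         (suc j)       = ≤ⱽ-refl
through-step {xs = x ∷ []}        _         (suc zero)    = 1ⱽ-maximum x
through-step {xs = _ ∷ []}        _         (suc (suc j)) = ≤ⱽ-refl
through-step {xs = _ ∷ _ ∷ _}     (x≤y ∷ _) (suc zero)    = x≤y
through-step {xs = _ ∷ _ ∷ _}     (_ ∷ l)   (suc (suc j)) = through-step l (suc j)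

through-end : ∀ {n} (xs : List (Vec Bool n)) → through xs (suc (length xs)) ≡ 1ⱽ
through-end []           = refl
through-end (_ ∷ [])     = refl
through-end (_ ∷ y ∷ xs) = through-end (y ∷ xs)

xor-of-up-set : ∀ c d → (d ≡ true → c ≡ true) → flips (bit c + (bit (c ∧ not d) + 0)) false ≡ d
xor-of-up-set true  true  _ = refl
xor-of-up-set true  false _ = refl
xor-of-up-set false false _ = refl
xor-of-up-set false true  d⇒c with () ← d⇒c refl

flips-full : ∀ a b → flips (suc (suc (bit (not a) + bit (not b)))) a ≡ b
flips-full false false = refl
flips-full false true  = refl
flips-full true  false = refl
flips-full true  true  = refl

flips-¬ : ∀ a → flips (bit (not a) + 0) a ≡ true
flips-¬ false = refl
flips-¬ true  = refl

∧-Closed : SetΩ → Set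
∧-Closed P = ∀ {m} (f g : BF (suc m)) → P (m , f) → P (m , g) → P (m , tab (eval f ∧ᶠ eval g))

∧-Closed⇒Λc-closed : ∀ {P} → ∧-Closed P → (Λc · P) ⊆ P
∧-Closed⇒Λc-closed {P} ∧-closed (_ , m , f , gs , f∈Λc , gs∈P , refl) = go f∈Λc gs gs∈P
  where
  go : ∀ {h} → Λc h → ∀ {m} (gs : Fin (suc (proj₁ h)) → BF (suc m)) → (∀ i → P (m , gs i)) →
       P (m , compose (proj₂ h) gs)
  go (gen refl) gs gs∈P =
    subst (λ g → P (_ , g))
          (tab-cong λ x → sym (eval-tab (λ v → lookup v zero ∧ lookup v (suc zero)) (tabulate (λ i → eval (gs i) x))))
          (∧-closed (gs zero) (gs (suc zero)) (gs∈P zero) (gs∈P (suc zero)))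
  go (proj n i) gs gs∈P = subst (λ g → P (_ , g)) (sym (compose-projection i gs)) (gs∈P i)
  go (comp f gs′ f∈Λc gs′∈Λc) hs hs∈P =
    subst (λ g → P (_ , g)) (sym (compose-assoc f gs′ hs)) (go f∈Λc _ (λ i → go (gs′∈Λc i) hs hs∈P))

module RightClosed (K : SetΩ) (closed : (K · Mc) ⊆ K) where

  ∈-∘-monotone : ∀ {n m} {h : BF (suc n)} → K (n , h) →
                 (φ : Vec Bool (suc m) → Vec Bool (suc n)) → Monotone φ → φ 0ⱽ ≡ 0ⱽ → φ 1ⱽ ≡ 1ⱽ →
                 K (m , tab (eval h ∘ φ))
  ∈-∘-monotone {n} {m} {h} h∈K φ mono φ0 φ1 =
    ∈-tab K (closed (n , m , h , coord , h∈K , coord∈Mc , refl)) λ x →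
      trans (eval-compose h coord x)
            (cong (eval h) (trans (tabulate-cong (λ i → eval-tab (λ u → lookup (φ u) i) x))
                                  (tabulate∘lookup (φ x))))
    where
    coord : Fin (suc n) → BF (suc m)
    coord i = tab (λ u → lookup (φ u) i)
    coord-at : ∀ i {u} {v : Vec Bool (suc n)} → φ u ≡ v → eval (coord i) u ≡ lookup v i
    coord-at i {u} refl = eval-tab (λ u → lookup (φ u) i) u
    coord∈Mc : ∀ i → Mc (m , coord i)
    coord∈Mc i =
        (λ x y x≤y → subst₂ _≤ᵇ_ (sym (coord-at i {x} refl)) (sym (coord-at i {y} refl))
                                (PW.lookup (mono x≤y) i))
      , trans (coord-at i φ0) (lookup-replicate i false)
      , trans (coord-at i φ1) (lookup-replicate i true)

  ∈-minor : ∀ {k m} {h : BF (suc k)} → K (k , h) → (σ : Fin (suc k) → Fin (suc m)) →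
            K (m , tab (λ u → eval h (tabulate (lookup u ∘ σ))))
  ∈-minor h∈K σ =
    ∈-∘-monotone h∈K (λ u → tabulate (lookup u ∘ σ)) (λ u≤v → PW.tabulate⁺ (PW.lookup u≤v ∘ σ))
      (tabulate-constant (λ i → lookup-replicate (σ i) false))
      (tabulate-constant (λ i → lookup-replicate (σ i) true))

  ∈-diagonal : ∀ {n} {h : BF (suc n)} → K (n , h) → K (0 , (eval h 0ⱽ , eval h 1ⱽ))
  ∈-diagonal {n} {h} h∈K =
    ∈-∘-monotone h∈K (replicate (suc n) ∘ head) (λ { (p ∷ _) → replicate-mono (suc n) p }) refl refl

  ∈-if : ∀ {m t₀ t₁} → K (0 , (t₀ , t₁)) → (G : Vec Bool (suc m) → Bool) →
         Increasing G → G 0ⱽ ≡ false → G 1ⱽ ≡ true → K (m , tab (λ u → if G u then t₁ else t₀))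
  ∈-if t∈K G mono g0 g1 =
    ∈-∘-monotone t∈K (λ u → G u ∷ []) (λ u≤v → implies⇒≤ᵇ (mono u≤v) ∷ [])
      (cong (_∷ []) g0) (cong (_∷ []) g1)

  ∈-flips∘rank : ∀ {k m a} → K (k , parity a k) → (r : Vec Bool (suc m) → ℕ) →
                 (∀ {x y} → x ≤ⱽ y → r x ≤ r y) → r 0ⱽ ≡ 0 → r 1ⱽ ≡ suc k →
                 K (m , tab (λ u → flips (r u) a))
  ∈-flips∘rank {k} {a = a} p∈K r mono r0 r1 =
    ∈-tab K {F = λ u → flips (r u) a} (∈-∘-monotone p∈K (stdChain (suc k) ∘ r) (stdChain-mono (suc k) ∘ mono)
               (trans (cong (stdChain (suc k)) r0) (stdChain-0 (suc k)))
               (trans (cong (stdChain (suc k)) r1) (stdChain-top (suc k))))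
      λ u → trans (eval-tab (eval (parity a k) ∘ stdChain (suc k) ∘ r) u)
                  (trans (eval-tab (λ x → flips (weight x) a) (stdChain (suc k) (r u)))
              (cong (λ j → flips j a) (weight-stdChain (suc k) (subst (r u ≤_) r1 (mono (1ⱽ-maximum u))))))

  parity-∈ : ∀ {n} k {a} {h : BF (suc n)} → K (n , h) →
             (c : ℕ → Vec Bool (suc n)) → (∀ j → c j ≤ⱽ c (suc j)) → c 0 ≡ 0ⱽ → c (suc k) ≡ 1ⱽ →
             (∀ (j : Fin (suc (suc k))) → eval h (c (toℕ j)) ≡ flips (toℕ j) a) →
             K (k , parity a k)
  parity-∈ k {a} {h} h∈K c step c0 c1 alternates =
    ∈-tab K {F = λ v → flips (weight v) a} (∈-∘-monotone h∈K (c ∘ weight) (chain-mono c step ∘ weight-mono)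
               (trans (cong c (weight-0ⱽ (suc k))) c0) (trans (cong c (weight-1ⱽ (suc k))) c1))
      λ v → trans (eval-tab (eval h ∘ c ∘ weight) v)
              (subst (λ j → eval h (c j) ≡ flips j a) (toℕ-fromℕ< _) (alternates (fromℕ< (s≤s (weight-≤ v)))))


module LeftClosed (K : SetΩ) (closed : (Λc · K) ⊆ K) where

  ∈-∧ : ∧-Closed K
  ∈-∧ {m} f g f∈K g∈K =
    ∈-tab K {F = eval f ∧ᶠ eval g} (closed (1 , m , and₂ , args , gen refl , args∈K , refl)) λ x →
      trans (eval-compose and₂ args x) (eval-tab (λ v → lookup v zero ∧ lookup v (suc zero)) (eval f x ∷ eval g x ∷ []))
    where
    args : Fin 2 → BF (suc m)
    args zero       = f
    args (suc zero) = g
    args∈K : ∀ i → K (m , args i)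
    args∈K zero       = f∈K
    args∈K (suc zero) = g∈K

  ∈-∀ᵇ : ∀ {m} n (k : Vec Bool n → Vec Bool (suc m) → Bool) → (∀ z → K (m , tab (k z))) →
         K (m , tab (λ u → ∀ᵇ (λ z → k z u)))
  ∈-∀ᵇ zero    k k∈K = k∈K []
  ∈-∀ᵇ (suc n) k k∈K =
    ∈-tab K {F = λ u → ∀ᵇ (λ z → k z u)}
      (∈-∧ _ _ (∈-∀ᵇ n (k ∘ (false ∷_)) (k∈K ∘ (false ∷_))) (∈-∀ᵇ n (k ∘ (true ∷_)) (k∈K ∘ (true ∷_))))
      λ u → trans (eval-tab (λ u → eval (tab all₀) u ∧ eval (tab all₁) u) u)
                  (cong₂ _∧_ (eval-tab all₀ u) (eval-tab all₁ u))
    where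
    all₀ all₁ : Vec Bool (suc _) → Bool
    all₀ u = ∀ᵇ (λ z → k (false ∷ z) u)
    all₁ u = ∀ᵇ (λ z → k (true ∷ z) u)

-- Codes and the clonoids they describe

-- A code lists the levels of the functions of type 00, 01, 10 and 11 in a clonoid: none, the
-- basic class (constant 0, increasing, decreasing, constant 1), for type 00 the convex
-- functions, or all functions.
pattern none   = zero
pattern basic  = suc zero
pattern convex = suc (suc zero)
pattern full₃  = suc (suc zero)
pattern full₄  = suc (suc (suc zero))

level₃ : ∀ {X : Set} → (X → Set) → Fin 3 → X → Set
level₃ P none  _ = ⊥
level₃ P basic x = P x
level₃ P full₃ _ = ⊤

level₄ : ∀ {X : Set} → (X → Set) → (X → Set) → Fin 4 → X → Set
level₄ P Q none   _ = ⊥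
level₄ P Q basic  x = P x
level₄ P Q convex x = Q x
level₄ P Q full₄  _ = ⊤

Code : Set
Code = Fin 4 × Fin 3 × Fin 3 × Fin 3

ClassOfType : Code → Bool → Bool → ∀ {n} → (Vec Bool n → Bool) → Set
ClassOfType (A , _ , _ , _) false false = level₄ (Constant false) Convex A
ClassOfType (_ , B , _ , _) false true  = level₃ Increasing B
ClassOfType (_ , _ , C , _) true  false = level₃ Decreasing C
ClassOfType (_ , _ , _ , D) true  true  = level₃ (Constant true) D

Class : Code → ∀ {n} → (Vec Bool (suc n) → Bool) → Set
Class c F = ClassOfType c (F 0ⱽ) (F 1ⱽ) F

⟦_⟧ : Code → SetΩ
⟦ c ⟧ (n , h) = Class c (eval h)

isNone notFull : Fin 3 → Bool
isNone none = true
isNone _    = false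
notFull full₃ = false
notFull _     = true

compatible : Fin 3 → Fin 3 → Bool
compatible basic full₃ = false
compatible _     _     = true

-- The exclusions come from id∧neg⇒xor₂, xor₂∧full₀₁⇒full₀₀ (and its 10, 11 variants),
-- id∧full₁₁⇒full₀₁ and full₁₁∧neg⇒full₁₀ below.
Admissible : Code → Set
Admissible (none   , B , C , D) = T (isNone B ∨ isNone C)
Admissible (basic  , B , C , D) = T (isNone B ∨ isNone C)
Admissible (convex , B , C , D) = T (notFull B) × T (notFull C) × T (notFull D)
Admissible (full₄  , B , C , D) = ⊤

Valid : Code → Set
Valid c@(_ , B , C , D) = Admissible c × T (compatible B D) × T (compatible C D)

level₃-map : ∀ {X Y : Set} {P : X → Set} {Q : Y → Set} {x y} ℓ → (P x → Q y) → level₃ P ℓ x → level₃ Q ℓ y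
level₃-map basic P⇒Q = P⇒Q
level₃-map full₃ _   _ = tt

level₄-map : ∀ {X Y : Set} {P P′ : X → Set} {Q Q′ : Y → Set} {x y} ℓ →
             (P x → Q y) → (P′ x → Q′ y) → level₄ P P′ ℓ x → level₄ Q Q′ ℓ y
level₄-map basic  P⇒Q _     = P⇒Q
level₄-map convex _   P⇒Q   = P⇒Q
level₄-map full₄  _   _     _ = tt

record Preserves {m n} (F : Vec Bool m → Bool) (G : Vec Bool n → Bool) : Set where
  field
    increasing : Increasing F → Increasing G
    decreasing : Decreasing F → Decreasing G
    convexity  : Convex F → Convex G
    constancy  : ∀ {b} → Constant b F → Constant b G

open Preserves

ClassOfType-map : ∀ c a b {m n} {F : Vec Bool m → Bool} {G : Vec Bool n → Bool} →
                  Preserves F G → ClassOfType c a b F → ClassOfType c a b G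
ClassOfType-map (A , _ , _ , _) false false p = level₄-map A (constancy p) (convexity p)
ClassOfType-map (_ , B , _ , _) false true  p = level₃-map B (increasing p)
ClassOfType-map (_ , _ , C , _) true  false p = level₃-map C (decreasing p)
ClassOfType-map (_ , _ , _ , D) true  true  p = level₃-map D (constancy p)

preserves-≗ : ∀ {n} {F G : Vec Bool n → Bool} → F ≗ G → Preserves F G
preserves-≗ {F = F} {G} F≗G = record
  { increasing = λ inc x≤y Gx → to (inc x≤y (from Gx))
  ; decreasing = λ dec x≤y Gy → to (dec x≤y (from Gy))
  ; convexity  = λ conv x≤y y≤z Gx Gz → to (conv x≤y y≤z (from Gx) (from Gz))
  ; constancy  = λ cst x → to (cst x)
  }
  where
  to : ∀ {x b} → F x ≡ b → G x ≡ b
  to {x} = trans (sym (F≗G x))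
  from : ∀ {x b} → G x ≡ b → F x ≡ b
  from {x} = trans (F≗G x)

preserves-∘ : ∀ {m n} {F : Vec Bool n → Bool} (φ : Vec Bool m → Vec Bool n) → Monotone φ → Preserves F (F ∘ φ)
preserves-∘ φ mono = record
  { increasing = λ inc → inc ∘ mono
  ; decreasing = λ dec → dec ∘ mono
  ; convexity  = λ conv x≤y y≤z → conv (mono x≤y) (mono y≤z)
  ; constancy  = λ cst → cst ∘ φ
  }

preserves-trans : ∀ {k m n} {F : Vec Bool k → Bool} {G : Vec Bool m → Bool} {H : Vec Bool n → Bool} →
                  Preserves F G → Preserves G H → Preserves F H
preserves-trans p q = record
  { increasing = increasing q ∘ increasing p
  ; decreasing = decreasing q ∘ decreasing p
  ; convexity  = convexity q ∘ convexity p
  ; constancy  = constancy q ∘ constancy p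
  }

Class-transport : ∀ c {m n} {F : Vec Bool (suc m) → Bool} {G : Vec Bool (suc n) → Bool} →
                  Preserves F G → F 0ⱽ ≡ G 0ⱽ → F 1ⱽ ≡ G 1ⱽ → Class c F → Class c G
Class-transport c {F = F} {G} p F0≡G0 F1≡G1 =
  subst₂ (λ a b → ClassOfType c a b G) F0≡G0 F1≡G1 ∘ ClassOfType-map c (F 0ⱽ) (F 1ⱽ) p

⟦⟧-closedʳ : ∀ c → (⟦ c ⟧ · Mc) ⊆ ⟦ c ⟧
⟦⟧-closedʳ c (n , m , f , gs , f∈⟦c⟧ , gs∈Mc , refl) =
  Class-transport c (preserves-trans (preserves-∘ {F = eval f} φ φ-mono) (preserves-≗ (sym ∘ eval-compose f gs)))
    (at {0ⱽ} φ-0ⱽ) (at {1ⱽ} φ-1ⱽ) f∈⟦c⟧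
  where
  φ : Vec Bool (suc m) → Vec Bool (suc n)
  φ u = tabulate (λ i → eval (gs i) u)
  φ-mono : Monotone φ
  φ-mono x≤y = PW.tabulate⁺ (λ i → proj₁ (gs∈Mc i) _ _ x≤y)
  φ-0ⱽ : φ 0ⱽ ≡ 0ⱽ
  φ-0ⱽ = tabulate-constant (proj₁ ∘ proj₂ ∘ gs∈Mc)
  φ-1ⱽ : φ 1ⱽ ≡ 1ⱽ
  φ-1ⱽ = tabulate-constant (proj₂ ∘ proj₂ ∘ gs∈Mc)
  at : ∀ {u v} → φ u ≡ v → eval f v ≡ eval (compose f gs) u
  at {u} refl = sym (eval-compose f gs u)

module _ {n} {F G : Vec Bool n → Bool} where

  increasing-∧ : Increasing F → Increasing G → Increasing (F ∧ᶠ G)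
  increasing-∧ incF incG x≤y FGx = ∧-intro (incF x≤y (∧-elimˡ FGx)) (incG x≤y (∧-elimʳ {F _} FGx))

  decreasing-∧ : Decreasing F → Decreasing G → Decreasing (F ∧ᶠ G)
  decreasing-∧ decF decG x≤y FGy = ∧-intro (decF x≤y (∧-elimˡ FGy)) (decG x≤y (∧-elimʳ {F _} FGy))

  convex-∧ : Convex F → Convex G → Convex (F ∧ᶠ G)
  convex-∧ convF convG x≤y y≤z FGx FGz =
    ∧-intro (convF x≤y y≤z (∧-elimˡ FGx) (∧-elimˡ FGz)) (convG x≤y y≤z (∧-elimʳ {F _} FGx) (∧-elimʳ {F _} FGz))

  constant-true-∧ : Constant true F → Constant true G → Constant true (F ∧ᶠ G)
  constant-true-∧ cF cG x = ∧-intro (cF x) (cG x)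

  constant-false-∧ : Constant false F → Constant false (F ∧ᶠ G)
  constant-false-∧ cF x = cong (_∧ G x) (cF x)

module _ {n} {F : Vec Bool n → Bool} where

  increasing⇒convex : Increasing F → Convex F
  increasing⇒convex inc x≤y _ Fx _ = inc x≤y Fx

  decreasing⇒convex : Decreasing F → Convex F
  decreasing⇒convex dec _ y≤z _ Fz = dec y≤z Fz

  constant-true⇒increasing : Constant true F → Increasing F
  constant-true⇒increasing cst _ _ = cst _

  constant-true⇒decreasing : Constant true F → Decreasing F
  constant-true⇒decreasing cst _ _ = cst _

  constant⇒convex : ∀ {b} → Constant b F → Convex F
  constant⇒convex {true}  cst _ _ _ _  = cst _
  constant⇒convex {false} cst _ _ Fx _ with () ← trans (sym Fx) (cst _)

convex-member : ∀ {B C D} → Admissible (convex , B , C , D) → ∀ a b {n} {G : Vec Bool n → Bool} →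
                ClassOfType (convex , B , C , D) a b G → Convex G
convex-member             _            false false conv = conv
convex-member {B = basic} _            false true  inc  = increasing⇒convex inc
convex-member {C = basic} _            true  false dec  = decreasing⇒convex dec
convex-member {D = basic} _            true  true  cst  = constant⇒convex cst
convex-member {B = full₃} (() , _)     false true  _
convex-member {C = full₃} (_ , () , _) true  false _
convex-member {D = full₃} (_ , _ , ()) true  true  _

module _ {n} {F G : Vec Bool n → Bool} where

  level₃-∧ : ∀ ℓ {P : (Vec Bool n → Bool) → Set} → (P F → P G → P (F ∧ᶠ G)) →
             level₃ P ℓ F → level₃ P ℓ G → level₃ P ℓ (F ∧ᶠ G)
  level₃-∧ basic P-∧ = P-∧
  level₃-∧ full₃ _   _ _ = tt

  level₃-∧-constant : ∀ ℓ ℓ′ {P : (Vec Bool n → Bool) → Set} → T (compatible ℓ ℓ′) →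
                      (P F → Constant true G → P (F ∧ᶠ G)) →
                      level₃ P ℓ F → level₃ (Constant true) ℓ′ G → level₃ P ℓ (F ∧ᶠ G)
  level₃-∧-constant basic basic _ P-∧ = P-∧
  level₃-∧-constant basic full₃ ()
  level₃-∧-constant full₃ _     _ _   _ _ = tt

  level₄-∧ˡ : ∀ A B C D → Admissible (A , B , C , D) → ∀ a b →
              level₄ (Constant false) Convex A F → ClassOfType (A , B , C , D) a b G →
              level₄ (Constant false) Convex A (F ∧ᶠ G)
  level₄-∧ˡ basic  _ _ _ _   a b cst   _  = constant-false-∧ cst
  level₄-∧ˡ convex _ _ _ adm a b convF G∈ = convex-∧ convF (convex-member adm a b G∈)
  level₄-∧ˡ full₄  _ _ _ _   a b _     _  = tt

  increasing∧decreasing : ∀ A B C D → Admissible (A , B , C , D) →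
                          level₃ Increasing B F → level₃ Decreasing C G →
                          level₄ (Constant false) Convex A (F ∧ᶠ G)
  increasing∧decreasing _      none  _     _ _            ()  _
  increasing∧decreasing _      _     none  _ _            _   ()
  increasing∧decreasing none   (suc _) (suc _) _ ()
  increasing∧decreasing basic  (suc _) (suc _) _ ()
  increasing∧decreasing convex basic basic _ _            inc dec =
    convex-∧ (increasing⇒convex inc) (decreasing⇒convex dec)
  increasing∧decreasing convex full₃ _     _ (() , _)
  increasing∧decreasing convex basic full₃ _ (_ , () , _)
  increasing∧decreasing full₄  _     _     _ _            _   _   = tt

∧-ClassOfType : ∀ {c} → Valid c → ∀ a₁ b₁ a₂ b₂ {n} (F G : Vec Bool n → Bool) →
                ClassOfType c a₁ b₁ F → ClassOfType c a₂ b₂ G → ClassOfType c (a₁ ∧ a₂) (b₁ ∧ b₂) (F ∧ᶠ G)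
∧-ClassOfType {c@(A , B , C , D)} (adm , compatibleᴮ , compatibleᶜ) = go
  where
  module _ {n} (F G : Vec Bool n → Bool) where
    swap : ∀ a b → ClassOfType c a b (G ∧ᶠ F) → ClassOfType c a b (F ∧ᶠ G)
    swap a b = ClassOfType-map c a b (preserves-≗ (∧ᶠ-comm G F))
  module _ {n} {F G : Vec Bool n → Bool} where
    increasing∧constant : level₃ Increasing B F → level₃ (Constant true) D G → level₃ Increasing B (F ∧ᶠ G)
    increasing∧constant =
      level₃-∧-constant B D compatibleᴮ λ inc cst → increasing-∧ inc (constant-true⇒increasing cst)
    decreasing∧constant : level₃ Decreasing C F → level₃ (Constant true) D G → level₃ Decreasing C (F ∧ᶠ G)
    decreasing∧constant =
      level₃-∧-constant C D compatibleᶜ λ dec cst → decreasing-∧ dec (constant-true⇒decreasing cst)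
  go : ∀ a₁ b₁ a₂ b₂ {n} (F G : Vec Bool n → Bool) →
       ClassOfType c a₁ b₁ F → ClassOfType c a₂ b₂ G → ClassOfType c (a₁ ∧ a₂) (b₁ ∧ b₂) (F ∧ᶠ G)
  go false false a₂    b₂    F G F∈ G∈ = level₄-∧ˡ A B C D adm a₂ b₂ F∈ G∈
  go false true  false false F G F∈ G∈ = swap F G false false (level₄-∧ˡ A B C D adm false true G∈ F∈)
  go true  false false false F G F∈ G∈ = swap F G false false (level₄-∧ˡ A B C D adm true false G∈ F∈)
  go true  true  false false F G F∈ G∈ = swap F G false false (level₄-∧ˡ A B C D adm true true G∈ F∈)
  go false true  false true  F G F∈ G∈ = level₃-∧ B increasing-∧ F∈ G∈
  go false true  true  false F G F∈ G∈ = increasing∧decreasing A B C D adm F∈ G∈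
  go false true  true  true  F G F∈ G∈ = increasing∧constant F∈ G∈
  go true  false false true  F G F∈ G∈ = swap F G false false (increasing∧decreasing A B C D adm G∈ F∈)
  go true  false true  false F G F∈ G∈ = level₃-∧ C decreasing-∧ F∈ G∈
  go true  false true  true  F G F∈ G∈ = decreasing∧constant F∈ G∈
  go true  true  false true  F G F∈ G∈ = swap F G false true (increasing∧constant G∈ F∈)
  go true  true  true  false F G F∈ G∈ = swap F G true false (decreasing∧constant G∈ F∈)
  go true  true  true  true  F G F∈ G∈ = level₃-∧ D constant-true-∧ F∈ G∈

⟦⟧-∧-Closed : ∀ {c} → Valid c → ∧-Closed ⟦ c ⟧
⟦⟧-∧-Closed {c} v f g f∈ g∈ =
  Class-transport c (preserves-≗ (sym ∘ eval-tab H)) (sym (eval-tab H 0ⱽ)) (sym (eval-tab H 1ⱽ))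
    (∧-ClassOfType {c} v (eval f 0ⱽ) (eval f 1ⱽ) (eval g 0ⱽ) (eval g 1ⱽ) (eval f) (eval g) f∈ g∈)
  where
  H : Vec Bool (suc _) → Bool
  H = eval f ∧ᶠ eval g

⟦⟧-IsClonoid : ∀ {c} → Valid c → IsClonoid Mc Λc ⟦ c ⟧
⟦⟧-IsClonoid {c} v = ⟦⟧-closedʳ c , ∧-Closed⇒Λc-closed {⟦ c ⟧} (⟦⟧-∧-Closed {c} v)

unary : Bool → Bool → Ω
unary a b = 0 , (a , b)

xor₂ : Ω
xor₂ = 1 , parity false 1

-- full a b alternates 2 + [a = false] + [b = false] times along a maximal chain, as often as
-- a function of type (a , b) that vanishes at a single interior point.
fullArity : Bool → Bool → ℕ
fullArity a b = suc (bit (not a) + bit (not b))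

full : Bool → Bool → Ω
full a b = fullArity a b , parity a (fullArity a b)

level₃-≤ : ∀ {X Y : Set} {P : X → Set} {Q : Y → Set} {x y} ℓ ℓ′ → P x → ¬ Q y →
           (level₃ P ℓ x → level₃ P ℓ′ x) → (level₃ Q ℓ y → level₃ Q ℓ′ y) → ℓ ≤ᶠ ℓ′
level₃-≤ none  _     _  _   _  _  = z≤n
level₃-≤ basic none  Px _   ⊆x _  = ⊥-elim (⊆x Px)
level₃-≤ basic basic _  _   _  _  = ℕ.≤-refl
level₃-≤ basic full₃ _  _   _  _  = s≤s z≤n
level₃-≤ full₃ none  _  _   _  ⊆y = ⊥-elim (⊆y tt)
level₃-≤ full₃ basic _  ¬Qy _  ⊆y = ⊥-elim (¬Qy (⊆y tt))
level₃-≤ full₃ full₃ _  _   _  _  = ℕ.≤-refl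

level₄-≤ : ∀ {X Y Z : Set} {P Q : X → Set} {P′ Q′ : Y → Set} {P″ Q″ : Z → Set} {x y z} ℓ ℓ′ →
           P x → Q′ y → ¬ P′ y → ¬ P″ z → ¬ Q″ z →
           (level₄ P Q ℓ x → level₄ P Q ℓ′ x) → (level₄ P′ Q′ ℓ y → level₄ P′ Q′ ℓ′ y) →
           (level₄ P″ Q″ ℓ z → level₄ P″ Q″ ℓ′ z) → ℓ ≤ᶠ ℓ′
level₄-≤ none   _      _  _   _    _    _    _  _  _  = z≤n
level₄-≤ basic  none   Px _   _    _    _    ⊆x _  _  = ⊥-elim (⊆x Px)
level₄-≤ basic  basic  _  _   _    _    _    _  _  _  = ℕ.≤-refl
level₄-≤ basic  convex _  _   _    _    _    _  _  _  = s≤s z≤n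
level₄-≤ basic  full₄  _  _   _    _    _    _  _  _  = s≤s z≤n
level₄-≤ convex none   _  Q′y _    _    _    _  ⊆y _  = ⊥-elim (⊆y Q′y)
level₄-≤ convex basic  _  Q′y ¬P′y _    _    _  ⊆y _  = ⊥-elim (¬P′y (⊆y Q′y))
level₄-≤ convex convex _  _   _    _    _    _  _  _  = ℕ.≤-refl
level₄-≤ convex full₄  _  _   _    _    _    _  _  _  = s≤s (s≤s z≤n)
level₄-≤ full₄  none   _  _   _    _    _    _  _  ⊆z = ⊥-elim (⊆z tt)
level₄-≤ full₄  basic  _  _   _    ¬P″z _    _  _  ⊆z = ⊥-elim (¬P″z (⊆z tt))
level₄-≤ full₄  convex _  _   _    _    ¬Q″z _  _  ⊆z = ⊥-elim (¬Q″z (⊆z tt))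
level₄-≤ full₄  full₄  _  _   _    _    _    _  _  _  = ℕ.≤-refl

constant-unary : ∀ b → Constant b (eval (proj₂ (unary b b)))
constant-unary b (false ∷ []) = refl
constant-unary b (true  ∷ []) = refl

increasing-id : Increasing (eval (proj₂ (unary false true)))
increasing-id (b≤b ∷ []) Fx = Fx
increasing-id (f≤t ∷ []) _  = refl

decreasing-not : Decreasing (eval (proj₂ (unary true false)))
decreasing-not (b≤b ∷ []) Fy = Fy
decreasing-not (f≤t ∷ []) _  = refl

xor₂-true⇒weight-1 : ∀ v → eval (parity false 1) v ≡ true → weight v ≡ 1
xor₂-true⇒weight-1 (false ∷ true  ∷ []) _ = refl
xor₂-true⇒weight-1 (true  ∷ false ∷ []) _ = refl

weight-1⇒xor₂-true : ∀ v → weight v ≡ 1 → eval (parity false 1) v ≡ true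
weight-1⇒xor₂-true v w≡1 = trans (eval-tab (λ x → flips (weight x) false) v) (cong (λ k → flips k false) w≡1)

xor₂-convex : Convex (eval (parity false 1))
xor₂-convex {x} {y} {z} x≤y y≤z Fx Fz = weight-1⇒xor₂-true y (ℕ.≤-antisym
  (subst (weight y ≤_) (xor₂-true⇒weight-1 z Fz) (weight-mono y≤z))
  (subst (_≤ weight y) (xor₂-true⇒weight-1 x Fx) (weight-mono x≤y)))

¬constant-xor₂ : ¬ Constant false (eval (parity false 1))
¬constant-xor₂ cst with () ← cst (true ∷ false ∷ [])

¬constant-full₀₀ : ¬ Constant false (eval (parity false 3))
¬constant-full₀₀ cst with () ← cst (true ∷ false ∷ false ∷ false ∷ [])

¬convex-full₀₀ : ¬ Convex (eval (parity false 3))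
¬convex-full₀₀ conv
  with () ← conv {true ∷ false ∷ false ∷ false ∷ []} {true ∷ true ∷ false ∷ false ∷ []}
                 {true ∷ true ∷ true ∷ false ∷ []}
                 (b≤b ∷ f≤t ∷ b≤b ∷ b≤b ∷ []) (b≤b ∷ b≤b ∷ f≤t ∷ b≤b ∷ []) refl refl

¬increasing-full₀₁ : ¬ Increasing (eval (parity false 2))
¬increasing-full₀₁ inc
  with () ← inc {true ∷ false ∷ false ∷ []} {true ∷ true ∷ false ∷ []} (b≤b ∷ f≤t ∷ b≤b ∷ []) refl

¬decreasing-full₁₀ : ¬ Decreasing (eval (parity true 2))
¬decreasing-full₁₀ dec
  with () ← dec {true ∷ false ∷ false ∷ []} {true ∷ true ∷ false ∷ []} (b≤b ∷ f≤t ∷ b≤b ∷ []) refl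

¬constant-full₁₁ : ¬ Constant true (eval (parity true 1))
¬constant-full₁₁ cst with () ← cst (true ∷ false ∷ [])

⟦⟧-⊆⇒≤ : ∀ {A B C D A′ B′ C′ D′} → ⟦ A , B , C , D ⟧ ⊆ ⟦ A′ , B′ , C′ , D′ ⟧ →
         A ≤ᶠ A′ × B ≤ᶠ B′ × C ≤ᶠ C′ × D ≤ᶠ D′
⟦⟧-⊆⇒≤ {A} {B} {C} {D} {A′} {B′} {C′} {D′} ⊆ =
    level₄-≤ {Q′ = Convex} A A′ (constant-unary false) xor₂-convex ¬constant-xor₂
             ¬constant-full₀₀ ¬convex-full₀₀
             (⊆ {unary false false}) (⊆ {xor₂}) (⊆ {full false false})
  , level₃-≤ {P = Increasing} B B′ increasing-id ¬increasing-full₀₁ (⊆ {unary false true}) (⊆ {full false true})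
  , level₃-≤ {P = Decreasing} C C′ decreasing-not ¬decreasing-full₁₀ (⊆ {unary true false}) (⊆ {full true false})
  , level₃-≤ D D′ (constant-unary true) ¬constant-full₁₁ (⊆ {unary true true}) (⊆ {full true true})

⟦⟧-injective : ∀ {c c′} → ⟦ c ⟧ ≐ ⟦ c′ ⟧ → c ≡ c′
⟦⟧-injective {A , B , C , D} {A′ , B′ , C′ , D′} (⊆ , ⊇)
  with A≤ , B≤ , C≤ , D≤ ← ⟦⟧-⊆⇒≤ {A} {B} {C} {D} {A′} {B′} {C′} {D′} (λ {x} → ⊆ {x})
     | A≥ , B≥ , C≥ , D≥ ← ⟦⟧-⊆⇒≤ {A′} {B′} {C′} {D′} {A} {B} {C} {D} (λ {x} → ⊇ {x})
  rewrite ≤ᶠ-antisym A≤ A≥ | ≤ᶠ-antisym B≤ B≥ | ≤ᶠ-antisym C≤ C≥ | ≤ᶠ-antisym D≤ D≥ = refl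

-- Classification of a clonoid

head-increasing : ∀ {n} → Increasing (head {n = n})
head-increasing (p ∷ _) = ≤ᵇ⇒implies p

increasing-∨ : ∀ {n} {F G : Vec Bool n → Bool} → Increasing F → Increasing G → Increasing (λ u → F u ∨ G u)
increasing-∨ {F = F} {G} incF incG {x} {y} x≤y with F x in Fx
... | true  = λ _ → cong (_∨ G y) (incF x≤y Fx)
... | false = λ Gx → trans (cong (F y ∨_) (incG x≤y Gx)) (∨-zeroʳ (F y))

decreasing⇒not-increasing : ∀ {n} {F : Vec Bool n → Bool} → Decreasing F → Increasing (not ∘ F)
decreasing⇒not-increasing {F = F} dec {x} {y} x≤y ¬Fx with F y in Fy
... | false = refl
... | true  with () ← trans (sym ¬Fx) (cong not (dec x≤y Fy))

above-increasing : ∀ {n} (w : Vec Bool n) → Increasing (λ u → does (w ≤?ⱽ u))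
above-increasing w x≤y w≤x = dec-true (w ≤?ⱽ _) (≤ⱽ-trans (does⇒ (w ≤?ⱽ _) w≤x) x≤y)

strictlyAbove-increasing : ∀ {n} (w : Vec Bool n) → Increasing (λ u → does (w ≤?ⱽ u) ∧ not (does (w ≟ⱽ u)))
strictlyAbove-increasing w {x} {y} x≤y w<x with w ≟ⱽ y
... | no _     = ∧-intro (above-increasing w x≤y (∧-elimˡ w<x)) refl
... | yes refl
  with () ← trans (sym (∧-elimʳ {does (w ≤?ⱽ x)} w<x))
                  (cong not (dec-true (w ≟ⱽ x) (≤ⱽ-antisym (does⇒ (w ≤?ⱽ x) (∧-elimˡ w<x)) x≤y)))

isOne-increasing : ∀ {n} → Increasing (λ (u : Vec Bool n) → does (u ≟ⱽ 1ⱽ))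
isOne-increasing {x = x} {y} x≤y x≡1 =
  dec-true (y ≟ⱽ 1ⱽ) (1ⱽ≤⇒≡1ⱽ (subst (_≤ⱽ y) (does⇒ (x ≟ⱽ 1ⱽ) x≡1) x≤y))

nonzero-increasing : ∀ {n} → Increasing (λ (u : Vec Bool n) → not (does (u ≟ⱽ 0ⱽ)))
nonzero-increasing {x = x} {y} x≤y x≢0 with y ≟ⱽ 0ⱽ
... | no _     = refl
... | yes refl with () ← trans (sym x≢0) (cong not (dec-true (x ≟ⱽ 0ⱽ) (≤0ⱽ⇒≡0ⱽ x≤y)))

if-true-false : ∀ b → (if b then true else false) ≡ b
if-true-false true  = refl
if-true-false false = refl

if-not-false-true : ∀ b → (if not b then false else true) ≡ b
if-not-false-true true  = refl
if-not-false-true false = refl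

module Classification (K : SetΩ) (closedʳ : (K · Mc) ⊆ K) (closedˡ : (Λc · K) ⊆ K) where
  open RightClosed K closedʳ
  open LeftClosed K closedˡ

  parity-∈-through : ∀ {n a} {h : BF (suc n)} → K (n , h) → (xs : List (Vec Bool (suc n))) → Linked _≤ⱽ_ xs →
                     (∀ (j : Fin (suc (suc (length xs)))) → eval h (through xs (toℕ j)) ≡ flips (toℕ j) a) →
                     K (length xs , parity a (length xs))
  parity-∈-through h∈K xs sorted = parity-∈ (length xs) h∈K (through xs) (through-step sorted) refl (through-end xs)

  -- The alternation along the standard chain is checked by evaluation.
  parity-∈-std : ∀ {k} a {h : BF (suc k)} → K (k , h) →
                 {True (all? λ j → eval h (stdChain (suc k) (toℕ j)) ≟ᵇ flips (toℕ j) a)} → K (k , parity a k)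
  parity-∈-std {k} a {h} h∈K {alternates} =
    parity-∈ k h∈K (stdChain (suc k)) (λ j → stdChain-mono (suc k) (ℕ.n≤1+n j))
      (stdChain-0 (suc k)) (stdChain-top (suc k))
      (toWitness {a? = all? λ j → eval h (stdChain (suc k) (toℕ j)) ≟ᵇ flips (toℕ j) a} alternates)

  module _ {n} {h : BF (suc n)} (h∈K : K (n , h)) where

    ∉xor₂⇒constant-false : ¬ K xor₂ → eval h 0ⱽ ≡ false → eval h 1ⱽ ≡ false → Constant false (eval h)
    ∉xor₂⇒constant-false ∉ h0 h1 x with eval h x in hx
    ... | false = refl
    ... | true  = ⊥-elim (∉ (parity-∈-through h∈K (x ∷ []) [-]
                    λ { zero → h0 ; (suc zero) → hx ; (suc (suc zero)) → h1 }))

    ∉full₀₀⇒convex : ¬ K (full false false) → eval h 0ⱽ ≡ false → eval h 1ⱽ ≡ false → Convex (eval h)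
    ∉full₀₀⇒convex ∉ h0 h1 {x} {y} {z} x≤y y≤z hx hz with eval h y in hy
    ... | true  = refl
    ... | false = ⊥-elim (∉ (parity-∈-through h∈K (x ∷ y ∷ z ∷ []) (x≤y ∷ y≤z ∷ [-])
                    λ { zero → h0 ; (suc zero) → hx ; (suc (suc zero)) → hy ; (suc (suc (suc zero))) → hz
                      ; (suc (suc (suc (suc zero)))) → h1 }))

    ∉full₀₁⇒increasing : ¬ K (full false true) → eval h 0ⱽ ≡ false → eval h 1ⱽ ≡ true → Increasing (eval h)
    ∉full₀₁⇒increasing ∉ h0 h1 {x} {y} x≤y hx with eval h y in hy
    ... | true  = refl
    ... | false = ⊥-elim (∉ (parity-∈-through h∈K (x ∷ y ∷ []) (x≤y ∷ [-])
                    λ { zero → h0 ; (suc zero) → hx ; (suc (suc zero)) → hy ; (suc (suc (suc zero))) → h1 }))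

    ∉full₁₀⇒decreasing : ¬ K (full true false) → eval h 0ⱽ ≡ true → eval h 1ⱽ ≡ false → Decreasing (eval h)
    ∉full₁₀⇒decreasing ∉ h0 h1 {x} {y} x≤y hy with eval h x in hx
    ... | true  = refl
    ... | false = ⊥-elim (∉ (parity-∈-through h∈K (x ∷ y ∷ []) (x≤y ∷ [-])
                    λ { zero → h0 ; (suc zero) → hx ; (suc (suc zero)) → hy ; (suc (suc (suc zero))) → h1 }))

    ∉full₁₁⇒constant-true : ¬ K (full true true) → eval h 0ⱽ ≡ true → eval h 1ⱽ ≡ true → Constant true (eval h)
    ∉full₁₁⇒constant-true ∉ h0 h1 x with eval h x in hx
    ... | true  = refl
    ... | false = ⊥-elim (∉ (parity-∈-through h∈K (x ∷ []) [-]
                    λ { zero → h0 ; (suc zero) → hx ; (suc (suc zero)) → h1 }))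

  module _ {n} {h : BF (suc n)} where

    constant⇒∈ : ∀ b → K (unary b b) → Constant b (eval h) → K (n , h)
    constant⇒∈ b u∈K cst =
      ∈-≗ K (∈-if u∈K head head-increasing refl refl) λ u →
        trans (eval-tab (λ u → if head u then b else b) u) (trans (if-eta (head u)) (sym (cst u)))

    increasing⇒∈ : K (unary false true) → eval h 0ⱽ ≡ false → eval h 1ⱽ ≡ true → Increasing (eval h) → K (n , h)
    increasing⇒∈ u∈K h0 h1 inc =
      ∈-≗ K (∈-if u∈K (eval h) inc h0 h1) λ u →
        trans (eval-tab (λ u → if eval h u then true else false) u) (if-true-false (eval h u))

    decreasing⇒∈ : K (unary true false) → eval h 0ⱽ ≡ true → eval h 1ⱽ ≡ false → Decreasing (eval h) → K (n , h)
    decreasing⇒∈ u∈K h0 h1 dec =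
      ∈-≗ K (∈-if u∈K (not ∘ eval h) (decreasing⇒not-increasing dec) (cong not h0) (cong not h1)) λ u →
        trans (eval-tab (λ u → if not (eval h u) then false else true) u) (if-not-false-true (eval h u))

  id∧neg⇒xor₂ : K (unary false true) → K (unary true false) → K xor₂
  id∧neg⇒xor₂ id∈K neg∈K =
    parity-∈-std false (∈-∧ _ _ (∈-minor {m = 1} id∈K (λ _ → zero)) (∈-minor {m = 1} neg∈K (λ _ → suc zero)))

  xor₂∧full₀₁⇒full₀₀ : K xor₂ → K (full false true) → K (full false false)
  xor₂∧full₀₁⇒full₀₀ xor∈K full∈K =
    parity-∈-std false (∈-∧ _ _ (∈-minor {m = 3} xor∈K λ { zero → zero ; (suc zero) → suc (suc (suc zero)) })
                            (∈-minor {m = 3} full∈K inject₁))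

  xor₂∧full₁₀⇒full₀₀ : K xor₂ → K (full true false) → K (full false false)
  xor₂∧full₁₀⇒full₀₀ xor∈K full∈K =
    parity-∈-std false (∈-∧ _ _ (∈-minor {m = 3} xor∈K λ { zero → zero ; (suc zero) → suc (suc (suc zero)) })
                            (∈-minor {m = 3} full∈K suc))

  xor₂∧full₁₁⇒full₀₀ : K xor₂ → K (full true true) → K (full false false)
  xor₂∧full₁₁⇒full₀₀ xor∈K full∈K =
    parity-∈-std false (∈-∧ _ _ (∈-minor {m = 3} xor∈K λ { zero → zero ; (suc zero) → suc (suc (suc zero)) })
                            (∈-minor {m = 3} full∈K (suc ∘ inject₁)))

  id∧full₁₁⇒full₀₁ : K (unary false true) → K (full true true) → K (full false true)
  id∧full₁₁⇒full₀₁ id∈K full∈K =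
    parity-∈-std false (∈-∧ _ _ (∈-minor {m = 2} id∈K (λ _ → zero)) (∈-minor {m = 2} full∈K suc))

  full₁₁∧neg⇒full₁₀ : K (full true true) → K (unary true false) → K (full true false)
  full₁₁∧neg⇒full₁₀ full∈K neg∈K =
    parity-∈-std true (∈-∧ _ _ (∈-minor {m = 2} full∈K inject₁) (∈-minor {m = 2} neg∈K (λ _ → suc (suc zero))))

  full⇒unary : ∀ a b → K (full a b) → K (unary a b)
  full⇒unary false false = ∈-diagonal
  full⇒unary false true  = ∈-diagonal
  full⇒unary true  false = ∈-diagonal
  full⇒unary true  true  = ∈-diagonal

  module _ {n} {h : BF (suc n)} (xor∈K : K xor₂) (h0 : eval h 0ⱽ ≡ false) (h1 : eval h 1ⱽ ≡ false)
           (conv : Convex (eval h)) where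

    private
      F : Vec Bool (suc n) → Bool
      F = eval h

      -- h = U xor W, where U is the up-closure of the support of h and W = U ∧ ¬ h is
      -- increasing because h is convex.
      U W : Vec Bool (suc n) → Bool
      U u = ∃ᵇ (λ s → does (s ≤?ⱽ u) ∧ F s)
      W u = U u ∧ not (F u)

      U-intro : ∀ {s u} → s ≤ⱽ u → F s ≡ true → U u ≡ true
      U-intro {s} {u} s≤u Fs = ∃ᵇ-intro (λ s → does (s ≤?ⱽ u) ∧ F s) s (∧-intro (dec-true (s ≤?ⱽ u) s≤u) Fs)

      U-elim : ∀ {u} → U u ≡ true → ∃ λ s → s ≤ⱽ u × F s ≡ true
      U-elim {u} Uu with s , e ← ∃ᵇ-elim (λ s → does (s ≤?ⱽ u) ∧ F s) Uu =
        s , does⇒ (s ≤?ⱽ u) (∧-elimˡ e) , ∧-elimʳ {does (s ≤?ⱽ u)} e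

      U-increasing : Increasing U
      U-increasing x≤y Ux with s , s≤x , Fs ← U-elim Ux = U-intro (≤ⱽ-trans s≤x x≤y) Fs

      W-increasing : Increasing W
      W-increasing {x} {y} x≤y Wx with F y in Fy
      ... | false = ∧-intro (U-increasing x≤y (∧-elimˡ Wx)) refl
      ... | true with s , s≤x , Fs ← U-elim (∧-elimˡ Wx)
        with () ← trans (sym (∧-elimʳ {U x} Wx)) (cong not (conv s≤x x≤y Fs Fy))

      U-0ⱽ : U 0ⱽ ≡ false
      U-0ⱽ with U 0ⱽ in U0
      ... | false = refl
      ... | true with s , s≤0 , Fs ← U-elim U0
        with () ← trans (sym Fs) (trans (cong F (≤0ⱽ⇒≡0ⱽ s≤0)) h0)

    convex⇒∈ : K (n , h)
    convex⇒∈ with ∃ᵇ F in nonzero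
    ... | false = constant⇒∈ false (∈-diagonal xor∈K) (∃ᵇ-false F nonzero)
    ... | true  = ∈-≗ K (∈-∘-monotone xor∈K φ φ-mono φ-0ⱽ φ-1ⱽ) λ u →
                    trans (eval-tab (eval (parity false 1) ∘ φ) u)
                          (trans (eval-tab (λ x → flips (weight x) false) (φ u))
                                 (xor-of-up-set (U u) (F u) (U-intro {u} ≤ⱽ-refl)))
      where
      φ : Vec Bool (suc n) → Vec Bool 2
      φ u = U u ∷ W u ∷ []
      φ-mono : Monotone φ
      φ-mono x≤y = implies⇒≤ᵇ (U-increasing x≤y) ∷ implies⇒≤ᵇ (W-increasing x≤y) ∷ []
      φ-0ⱽ : φ 0ⱽ ≡ 0ⱽ
      φ-0ⱽ = cong (λ b → b ∷ (b ∧ not (F 0ⱽ)) ∷ []) U-0ⱽ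
      U-1ⱽ : U 1ⱽ ≡ true
      U-1ⱽ with s , Fs ← ∃ᵇ-elim F nonzero = U-intro (1ⱽ-maximum s) Fs
      φ-1ⱽ : φ 1ⱽ ≡ 1ⱽ
      φ-1ⱽ = cong₂ (λ b c → b ∷ (b ∧ not c) ∷ []) U-1ⱽ h1

  module _ {a b} (full∈K : K (full a b)) {n} {h : BF (suc n)} (h0 : eval h 0ⱽ ≡ a) (h1 : eval h 1ⱽ ≡ b) where

    private
      F : Vec Bool (suc n) → Bool
      F = eval h

      -- δ w is a at 0ⱽ, b at 1ⱽ and elsewhere false exactly at w; it is flips (rank w) a for a
      -- monotone rank, so full a b generates it.
      δ : Vec Bool (suc n) → Vec Bool (suc n) → Bool
      δ w u = if does (u ≟ⱽ 0ⱽ) then a else if does (u ≟ⱽ 1ⱽ) then b else not (does (w ≟ⱽ u))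

      rank : Vec Bool (suc n) → Vec Bool (suc n) → ℕ
      rank w u = bit (does (w ≤?ⱽ u))
               + (bit (does (u ≟ⱽ 1ⱽ) ∨ (does (w ≤?ⱽ u) ∧ not (does (w ≟ⱽ u))))
               + (bit (not (does (u ≟ⱽ 0ⱽ)) ∧ not a) + bit (does (u ≟ⱽ 1ⱽ) ∧ not b)))

      rank-mono : ∀ w {x y} → x ≤ⱽ y → rank w x ≤ rank w y
      rank-mono w x≤y =
        ℕ.+-mono-≤ (bit-increasing (above-increasing w) x≤y)
          (ℕ.+-mono-≤ (bit-increasing (increasing-∨ isOne-increasing (strictlyAbove-increasing w)) x≤y)
            (ℕ.+-mono-≤ (bit-increasing (increasing-∧ nonzero-increasing λ _ e → e) x≤y)
                      (bit-increasing (increasing-∧ isOne-increasing λ _ e → e) x≤y)))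

      -- Stated for any u ≡ 0ⱽ (resp. 1ⱽ): with-abstraction needs the decisions on a variable u.
      rank-0ⱽ : ∀ w → w ≢ 0ⱽ → ∀ u → u ≡ 0ⱽ → rank w u ≡ 0
      rank-0ⱽ w w≢0 u u≡0 with u ≟ⱽ 0ⱽ | u ≟ⱽ 1ⱽ | w ≤?ⱽ u
      ... | no u≢0 | _       | _       = ⊥-elim (u≢0 u≡0)
      ... | yes _  | yes u≡1 | _       = ⊥-elim (0ⱽ≢1ⱽ (trans (sym u≡0) u≡1))
      ... | yes _  | no _    | yes w≤u = ⊥-elim (w≢0 (≤0ⱽ⇒≡0ⱽ (subst (w ≤ⱽ_) u≡0 w≤u)))
      ... | yes _  | no _    | no _    = refl

      rank-1ⱽ : ∀ w u → u ≡ 1ⱽ → rank w u ≡ suc (fullArity a b)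
      rank-1ⱽ w u u≡1 with u ≟ⱽ 0ⱽ | u ≟ⱽ 1ⱽ | w ≤?ⱽ u
      ... | _       | no u≢1 | _      = ⊥-elim (u≢1 u≡1)
      ... | yes u≡0 | yes _  | _      = ⊥-elim (0ⱽ≢1ⱽ (trans (sym u≡0) u≡1))
      ... | no _    | yes _  | no w≰u = ⊥-elim (w≰u (subst (w ≤ⱽ_) (sym u≡1) (1ⱽ-maximum w)))
      ... | no _    | yes _  | yes _  = refl

      flips-rank≡δ : ∀ w → w ≢ 0ⱽ → ∀ u → flips (rank w u) a ≡ δ w u
      flips-rank≡δ w w≢0 u with u ≟ⱽ 0ⱽ | u ≟ⱽ 1ⱽ | w ≤?ⱽ u | w ≟ⱽ u
      ... | yes refl | yes 0≡1 | _       | _        = ⊥-elim (0ⱽ≢1ⱽ 0≡1)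
      ... | yes refl | no _    | yes w≤0 | _        = ⊥-elim (w≢0 (≤0ⱽ⇒≡0ⱽ w≤0))
      ... | yes refl | no _    | no _    | _        = refl
      ... | no _     | yes refl | no w≰1 | _        = ⊥-elim (w≰1 (1ⱽ-maximum w))
      ... | no _     | yes refl | yes _  | _        = flips-full a b
      ... | no _     | no _    | no w≰w  | yes refl = ⊥-elim (w≰w ≤ⱽ-refl)
      ... | no _     | no _    | no _    | no _     = flips-¬ a
      ... | no _     | no _    | yes _   | yes refl = cong not (flips-¬ a)
      ... | no _     | no _    | yes _   | no _     = trans (not-involutive _) (flips-¬ a)

      ∈-δ : ∀ w → w ≢ 0ⱽ → K (n , tab (δ w))
      ∈-δ w w≢0 =
        ∈-tab K (∈-flips∘rank full∈K (rank w) (rank-mono w) (rank-0ⱽ w w≢0 0ⱽ refl) (rank-1ⱽ w 1ⱽ refl)) λ u →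
        trans (eval-tab (λ u → flips (rank w u) a) u) (flips-rank≡δ w w≢0 u)

      -- h is the conjunction of the δ (σ z): σ z = z deletes a zero of h, σ z = 1ⱽ deletes nothing.
      σ : Vec Bool (suc n) → Vec Bool (suc n)
      σ z = if F z ∨ does (z ≟ⱽ 0ⱽ) then 1ⱽ else z

      σ-nonzero : ∀ z → σ z ≢ 0ⱽ
      σ-nonzero z σz≡0 with F z ∨ does (z ≟ⱽ 0ⱽ) in e
      ... | true  = 0ⱽ≢1ⱽ (sym σz≡0)
      ... | false with () ← trans (sym e) (trans (cong (F z ∨_) (dec-true (z ≟ⱽ 0ⱽ) σz≡0)) (∨-zeroʳ (F z)))

      σ≡⇒false : ∀ {z u} → u ≢ 1ⱽ → σ z ≡ u → F u ≡ false
      σ≡⇒false {z} u≢1 σz≡u with F z ∨ does (z ≟ⱽ 0ⱽ) in e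
      ... | true  = ⊥-elim (u≢1 (sym σz≡u))
      ... | false with refl ← σz≡u with F z in Fz
      ...   | false = refl
      ...   | true with () ← e

      σ-fixed : ∀ {u} → F u ≡ false → u ≢ 0ⱽ → σ u ≡ u
      σ-fixed {u} Fu u≢0 with F u ∨ does (u ≟ⱽ 0ⱽ) in e
      ... | false = refl
      ... | true with () ← trans (sym e) (cong₂ _∨_ Fu (dec-false (u ≟ⱽ 0ⱽ) u≢0))

      ⋀δ≡F : ∀ u → ∀ᵇ (λ z → δ (σ z) u) ≡ F u
      ⋀δ≡F u with u ≟ⱽ 0ⱽ | u ≟ⱽ 1ⱽ
      ... | yes refl | _        = trans (∀ᵇ-const {suc n} a) (sym h0)
      ... | no _     | yes refl = trans (∀ᵇ-const {suc n} b) (sym h1)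
      ... | no u≢0   | no u≢1 with F u in Fu
      ...   | true  = ∀ᵇ-intro (λ z → not (does (σ z ≟ⱽ u))) missesu
        where
        missesu : ∀ z → not (does (σ z ≟ⱽ u)) ≡ true
        missesu z with σ z ≟ⱽ u
        ... | no _    = refl
        ... | yes σz≡u with () ← trans (sym Fu) (σ≡⇒false {z} u≢1 σz≡u)
      ...   | false = ∀ᵇ-false (λ z → not (does (σ z ≟ⱽ u))) u
                        (trans (cong (λ v → not (does (v ≟ⱽ u))) (σ-fixed Fu u≢0)) (cong not (dec-true (u ≟ⱽ u) refl)))

    full⇒∈ : K (n , h)
    full⇒∈ = ∈-≗ K (∈-∀ᵇ (suc n) (λ z → δ (σ z)) (λ z → ∈-δ (σ z) (σ-nonzero z))) λ u →
      trans (eval-tab (λ u → ∀ᵇ (λ z → δ (σ z) u)) u) (⋀δ≡F u)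

  data Reading₃ (a b : Bool) : Fin 3 → Set where
    at-none  : ¬ K (unary a b) → Reading₃ a b none
    at-basic : K (unary a b) → ¬ K (full a b) → Reading₃ a b basic
    at-full  : K (full a b) → Reading₃ a b full₃

  data Reading₀₀ : Fin 4 → Set where
    at-none   : ¬ K (unary false false) → Reading₀₀ none
    at-basic  : K (unary false false) → ¬ K xor₂ → Reading₀₀ basic
    at-convex : K xor₂ → ¬ K (full false false) → Reading₀₀ convex
    at-full   : K (full false false) → Reading₀₀ full₄

  reading₃ : ∀ {a b} → Dec (K (unary a b)) → Dec (K (full a b)) → Σ (Fin 3) (Reading₃ a b)
  reading₃ _        (yes full∈) = full₃ , at-full full∈
  reading₃ (yes u∈) (no full∉)  = basic , at-basic u∈ full∉
  reading₃ (no u∉)  (no _)      = none  , at-none u∉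

  reading₀₀ : Dec (K (unary false false)) → Dec (K xor₂) → Dec (K (full false false)) → Σ (Fin 4) Reading₀₀
  reading₀₀ _        _         (yes full∈) = full₄  , at-full full∈
  reading₀₀ _        (yes x∈)  (no full∉)  = convex , at-convex x∈ full∉
  reading₀₀ (yes c∈) (no x∉)   (no _)      = basic  , at-basic c∈ x∉
  reading₀₀ (no c∉)  (no _)    (no _)      = none   , at-none c∉

  nonempty⇒unary : ∀ {a b ℓ} → Reading₃ a b (suc ℓ) → K (unary a b)
  nonempty⇒unary (at-basic u∈ _) = u∈
  nonempty⇒unary (at-full full∈) = full⇒unary _ _ full∈

  module _ {n} {h : BF (suc n)} where

    reading₃-⊆ : ∀ {a b ℓ} {P : (Vec Bool (suc n) → Bool) → Set} → Reading₃ a b ℓ → K (n , h) →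
                 eval h 0ⱽ ≡ a → eval h 1ⱽ ≡ b → (¬ K (full a b) → P (eval h)) → level₃ P ℓ (eval h)
    reading₃-⊆ (at-none u∉)    h∈K refl refl _       = u∉ (∈-diagonal h∈K)
    reading₃-⊆ (at-basic _ f∉) _   _    _    bounded = bounded f∉
    reading₃-⊆ (at-full _)     _   _    _    _       = tt

    ⊆-reading₃ : ∀ {a b ℓ} {P : (Vec Bool (suc n) → Bool) → Set} → Reading₃ a b ℓ →
                 eval h 0ⱽ ≡ a → eval h 1ⱽ ≡ b → (K (unary a b) → P (eval h) → K (n , h)) →
                 level₃ P ℓ (eval h) → K (n , h)
    ⊆-reading₃ (at-basic u∈ _) _  _  generate = generate u∈
    ⊆-reading₃ (at-full full∈) h0 h1 _        = λ _ → full⇒∈ full∈ h0 h1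

    reading₀₀-⊆ : ∀ {A} → Reading₀₀ A → K (n , h) → eval h 0ⱽ ≡ false → eval h 1ⱽ ≡ false →
                  level₄ (Constant false) Convex A (eval h)
    reading₀₀-⊆ (at-none c∉)     h∈K h0 h1 = c∉ (subst₂ (λ a b → K (unary a b)) h0 h1 (∈-diagonal h∈K))
    reading₀₀-⊆ (at-basic _ x∉)  h∈K h0 h1 = ∉xor₂⇒constant-false h∈K x∉ h0 h1
    reading₀₀-⊆ (at-convex _ f∉) h∈K h0 h1 = ∉full₀₀⇒convex h∈K f∉ h0 h1
    reading₀₀-⊆ (at-full _)      _   _  _  = tt

    ⊆-reading₀₀ : ∀ {A} → Reading₀₀ A → eval h 0ⱽ ≡ false → eval h 1ⱽ ≡ false →
                  level₄ (Constant false) Convex A (eval h) → K (n , h)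
    ⊆-reading₀₀ (at-basic c∈ _)  _  _  cst  = constant⇒∈ false c∈ cst
    ⊆-reading₀₀ (at-convex x∈ _) h0 h1 conv = convex⇒∈ x∈ h0 h1 conv
    ⊆-reading₀₀ (at-full full∈)  h0 h1 _    = full⇒∈ full∈ h0 h1

  id-or-neg-absent : ∀ {B C} → Reading₃ false true B → Reading₃ true false C → ¬ K xor₂ → T (isNone B ∨ isNone C)
  id-or-neg-absent {none}          _  _  _  = tt
  id-or-neg-absent {suc _} {none}  _  _  _  = tt
  id-or-neg-absent {suc _} {suc _} rB rC x∉ = ⊥-elim (x∉ (id∧neg⇒xor₂ (nonempty⇒unary rB) (nonempty⇒unary rC)))

  reading-notFull : ∀ {a b ℓ} → Reading₃ a b ℓ → ¬ K (full a b) → T (notFull ℓ)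
  reading-notFull (at-none _)      _  = tt
  reading-notFull (at-basic _ _)   _  = tt
  reading-notFull (at-full full∈) f∉ = f∉ full∈

  reading-compatible : ∀ {a b ℓ ℓ′} → Reading₃ a b ℓ → Reading₃ true true ℓ′ →
                  (K (unary a b) → K (full true true) → K (full a b)) → T (compatible ℓ ℓ′)
  reading-compatible (at-none _)      _              _        = tt
  reading-compatible (at-full _)      _              _        = tt
  reading-compatible (at-basic _ _)   (at-none _)    _        = tt
  reading-compatible (at-basic _ _)   (at-basic _ _) _        = tt
  reading-compatible (at-basic u∈ f∉) (at-full f∈)   generate = ⊥-elim (f∉ (generate u∈ f∈))

  module _ {A B C D} (rA : Reading₀₀ A) (rB : Reading₃ false true B) (rC : Reading₃ true false C)
           (rD : Reading₃ true true D) where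

    readings-valid : Valid (A , B , C , D)
    readings-valid = admissible rA , reading-compatible rB rD id∧full₁₁⇒full₀₁
                                      , reading-compatible rC rD (λ neg∈ full∈ → full₁₁∧neg⇒full₁₀ full∈ neg∈)
      where
      admissible : ∀ {A} → Reading₀₀ A → Admissible (A , B , C , D)
      admissible (at-none c∉)      = id-or-neg-absent rB rC (c∉ ∘ ∈-diagonal)
      admissible (at-basic _ x∉)   = id-or-neg-absent rB rC x∉
      admissible (at-convex x∈ f∉) = reading-notFull rB (f∉ ∘ xor₂∧full₀₁⇒full₀₀ x∈)
                                   , reading-notFull rC (f∉ ∘ xor₂∧full₁₀⇒full₀₀ x∈)
                                   , reading-notFull rD (f∉ ∘ xor₂∧full₁₁⇒full₀₀ x∈)
      admissible (at-full _)       = tt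

    K≐⟦readings⟧ : K ≐ ⟦ A , B , C , D ⟧
    K≐⟦readings⟧ = (λ {(n , h)} h∈K → K⊆ h∈K (eval h 0ⱽ) (eval h 1ⱽ) refl refl)
                 , (λ {(n , h)} → ⊆K (eval h 0ⱽ) (eval h 1ⱽ) refl refl)
      where
      K⊆ : ∀ {n} {h : BF (suc n)} → K (n , h) → ∀ a b → eval h 0ⱽ ≡ a → eval h 1ⱽ ≡ b →
           ClassOfType (A , B , C , D) a b (eval h)
      K⊆ h∈K false false h0 h1 = reading₀₀-⊆ rA h∈K h0 h1
      K⊆ h∈K false true  h0 h1 = reading₃-⊆ {P = Increasing} rB h∈K h0 h1 λ f∉ → ∉full₀₁⇒increasing h∈K f∉ h0 h1
      K⊆ h∈K true  false h0 h1 = reading₃-⊆ {P = Decreasing} rC h∈K h0 h1 λ f∉ → ∉full₁₀⇒decreasing h∈K f∉ h0 h1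
      K⊆ h∈K true  true  h0 h1 = reading₃-⊆ {P = Constant true} rD h∈K h0 h1 λ f∉ → ∉full₁₁⇒constant-true h∈K f∉ h0 h1
      ⊆K : ∀ {n} {h : BF (suc n)} a b → eval h 0ⱽ ≡ a → eval h 1ⱽ ≡ b →
           ClassOfType (A , B , C , D) a b (eval h) → K (n , h)
      ⊆K false false h0 h1 = ⊆-reading₀₀ rA h0 h1
      ⊆K false true  h0 h1 = ⊆-reading₃ {P = Increasing} rB h0 h1 λ u∈ → increasing⇒∈ u∈ h0 h1
      ⊆K true  false h0 h1 = ⊆-reading₃ {P = Decreasing} rC h0 h1 λ u∈ → decreasing⇒∈ u∈ h0 h1
      ⊆K true  true  h0 h1 = ⊆-reading₃ {P = Constant true} rD h0 h1 λ u∈ → constant⇒∈ true u∈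

  -- Which test functions K contains is not decidable, hence the double negation.
  classified : ¬ ¬ (∃ λ c → Valid c × K ≐ ⟦ c ⟧)
  classified no-code =
    ¬¬-excluded-middle λ c₀? → ¬¬-excluded-middle λ xor₂? → ¬¬-excluded-middle λ full₀₀? →
    ¬¬-excluded-middle λ id? → ¬¬-excluded-middle λ full₀₁? →
    ¬¬-excluded-middle λ neg? → ¬¬-excluded-middle λ full₁₀? →
    ¬¬-excluded-middle λ c₁? → ¬¬-excluded-middle λ full₁₁? →
    let A , rA = reading₀₀ c₀? xor₂? full₀₀?
        B , rB = reading₃ {false} {true} id? full₀₁?
        C , rC = reading₃ {true} {false} neg? full₁₀?
        D , rD = reading₃ {true} {true} c₁? full₁₁?
    in no-code ((A , B , C , D) , readings-valid rA rB rC rD , K≐⟦readings⟧ rA rB rC rD)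

admissible? : Decidable Admissible
admissible? (none   , B , C , D) = T? _
admissible? (basic  , B , C , D) = T? _
admissible? (convex , B , C , D) = T? _ ×-dec T? _ ×-dec T? _
admissible? (full₄  , B , C , D) = yes tt

valid? : Decidable Valid
valid? c@(_ , B , C , D) = admissible? c ×-dec T? (compatible B D) ×-dec T? (compatible C D)

codes : List Code
codes = cartesianProduct (allFin 4) (cartesianProduct (allFin 3) (cartesianProduct (allFin 3) (allFin 3)))

validCodes : Vec Code 56
validCodes = fromList (filter valid? codes)

_≟ᶜ_ : DecidableEquality Code
_≟ᶜ_ = ×-≡-dec _≟_ (×-≡-dec _≟_ (×-≡-dec _≟_ _≟_))

validCodes-unique : Unique validCodes
validCodes-unique = from-yes (allPairs? (λ c c′ → ¬? (c ≟ᶜ c′)) validCodes)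

validCodes-valid : ∀ i → Valid (lookup validCodes i)
validCodes-valid i = proj₂ (∈-filter⁻ valid? {xs = codes} (∈-fromList⁻ {xs = filter valid? codes} (∈-lookup i validCodes)))

validCodes-complete : ∀ c → Valid c → ∃ λ i → lookup validCodes i ≡ c
validCodes-complete c@(A , B , C , D) v = index c∈ , sym (lookup-index c∈)
  where
  c∈ : c ∈ validCodes
  c∈ = ∈-fromList⁺ (∈-filter⁺ valid? (∈-cartesianProduct⁺ (∈-allFin A)
          (∈-cartesianProduct⁺ (∈-allFin B) (∈-cartesianProduct⁺ (∈-allFin C) (∈-allFin D)))) v)

Λc-clonoid-listed : ∀ K → IsClonoid Mc Λc K → ¬ ¬ (∃ λ i → K ≐ ⟦ lookup validCodes i ⟧)
Λc-clonoid-listed K (closedʳ , closedˡ) = ¬¬-map listed (Classification.classified K closedʳ closedˡ)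
  where
  listed : (∃ λ c → Valid c × K ≐ ⟦ c ⟧) → ∃ λ i → K ≐ ⟦ lookup validCodes i ⟧
  listed (c , v , K≐⟦c⟧) with i , refl ← validCodes-complete c v = i , K≐⟦c⟧

-- Duality

dualBF : ∀ {n} → BF (suc n) → BF (suc n)
dualBF f = tab (λ x → not (eval f (map not x)))

eval-dualBF : ∀ {n} (f : BF (suc n)) → eval (dualBF f) ≗ λ x → not (eval f (map not x))
eval-dualBF f = eval-tab _

map-not-involutive : ∀ {n} (x : Vec Bool n) → map not (map not x) ≡ x
map-not-involutive x = trans (sym (map-∘ not not x)) (trans (map-cong not-involutive x) (map-id x))

dualBF-involutive : ∀ {n} (f : BF (suc n)) → dualBF (dualBF f) ≡ f
dualBF-involutive f = eval-injective λ x → begin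
  eval (dualBF (dualBF f)) x             ≡⟨ eval-dualBF (dualBF f) x ⟩
  not (eval (dualBF f) (map not x))      ≡⟨ cong not (eval-dualBF f (map not x)) ⟩
  not (not (eval f (map not (map not x)))) ≡⟨ not-involutive _ ⟩
  eval f (map not (map not x))           ≡⟨ cong (eval f) (map-not-involutive x) ⟩
  eval f x                               ∎
  where open ≡-Reasoning

dualBF-compose : ∀ {n m} (f : BF (suc n)) (gs : Fin (suc n) → BF (suc m)) →
                 dualBF (compose f gs) ≡ compose (dualBF f) (dualBF ∘ gs)
dualBF-compose f gs = eval-injective λ x → let y = λ i → eval (gs i) (map not x) in begin
  eval (dualBF (compose f gs)) x
    ≡⟨ eval-dualBF (compose f gs) x ⟩
  not (eval (compose f gs) (map not x))
    ≡⟨ cong not (eval-compose f gs (map not x)) ⟩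
  not (eval f (tabulate y))
    ≡⟨ cong (λ v → not (eval f v)) (tabulate-cong λ i → sym (not-involutive (y i))) ⟩
  not (eval f (tabulate (not ∘ not ∘ y)))
    ≡⟨ cong (λ v → not (eval f v)) (tabulate-∘ not (not ∘ y)) ⟩
  not (eval f (map not (tabulate (not ∘ y))))
    ≡⟨ cong (λ v → not (eval f (map not v))) (tabulate-cong λ i → sym (eval-dualBF (gs i) x)) ⟩
  not (eval f (map not (tabulate (λ i → eval (dualBF (gs i)) x))))
    ≡⟨ sym (eval-dualBF f _) ⟩
  eval (dualBF f) (tabulate (λ i → eval (dualBF (gs i)) x))
    ≡⟨ sym (eval-compose (dualBF f) (dualBF ∘ gs) x) ⟩
  eval (compose (dualBF f) (dualBF ∘ gs)) x
    ∎
  where open ≡-Reasoning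

dualBF-projection : ∀ n (i : Fin (suc n)) → dualBF (projection n i) ≡ projection n i
dualBF-projection n i = eval-injective λ x → begin
  eval (dualBF (projection n i)) x         ≡⟨ eval-dualBF (projection n i) x ⟩
  not (eval (projection n i) (map not x))  ≡⟨ cong not (eval-tab (λ y → lookup y i) (map not x)) ⟩
  not (lookup (map not x) i)               ≡⟨ cong not (lookup-map i not x) ⟩
  not (not (lookup x i))                   ≡⟨ not-involutive _ ⟩
  lookup x i                               ≡⟨ sym (eval-tab (λ y → lookup y i) x) ⟩
  eval (projection n i) x                  ∎
  where open ≡-Reasoning

dual-⟨⟩ : ∀ {F F′ : SetΩ} → (∀ {h} → F h → ⟨ F′ ⟩ (dual h)) → ∀ {h} → ⟨ F ⟩ h → ⟨ F′ ⟩ (dual h)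
dual-⟨⟩ F⇒ (gen h∈F) = F⇒ h∈F
dual-⟨⟩ F⇒ (proj n i) = subst (λ g → ⟨ _ ⟩ (n , g)) (sym (dualBF-projection n i)) (proj n i)
dual-⟨⟩ F⇒ (comp f gs f∈ gs∈) =
  subst (λ g → ⟨ _ ⟩ (_ , g)) (sym (dualBF-compose f gs))
        (comp (dualBF f) (dualBF ∘ gs) (dual-⟨⟩ F⇒ f∈) (dual-⟨⟩ F⇒ ∘ gs∈))

dual-Vc⊆Λc : ∀ {h} → Vc h → Λc (dual h)
dual-Vc⊆Λc = dual-⟨⟩ λ { refl → gen refl }

dual-Λc⊆Vc : ∀ {h} → Λc h → Vc (dual h)
dual-Λc⊆Vc = dual-⟨⟩ λ { refl → gen refl }

not-antitone : ∀ {a b} → a ≤ᵇ b → not b ≤ᵇ not a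
not-antitone b≤b = b≤b
not-antitone f≤t = f≤t

map-not-antitone : ∀ {n} {x y : Vec Bool n} → x ≤ⱽ y → map not y ≤ⱽ map not x
map-not-antitone []       = []
map-not-antitone (p ∷ ps) = not-antitone p ∷ map-not-antitone ps

Mc-dual : ∀ {n} {f : BF (suc n)} → Mc (n , f) → Mc (n , dualBF f)
Mc-dual {n} {f} (mono , f0 , f1) =
    (λ x y x≤y → subst₂ _≤ᵇ_ (sym (eval-dualBF f x)) (sym (eval-dualBF f y))
                   (not-antitone (mono _ _ (map-not-antitone x≤y))))
  , trans (eval-dualBF f 0ⱽ) (trans (cong (λ v → not (eval f v)) (map-replicate not false (suc n))) (cong not f1))
  , trans (eval-dualBF f 1ⱽ) (trans (cong (λ v → not (eval f v)) (map-replicate not true (suc n))) (cong not f0))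

dualSet⁻ : ∀ {L : SetΩ} {m} {g : BF (suc m)} → dualSet L (m , g) → L (m , dualBF g)
dualSet⁻ {L} ((m , f) , f∈L , refl) = subst (λ g → L (m , g)) (sym (dualBF-involutive f)) f∈L

dualSet-involutive : ∀ (K : SetΩ) → K ≐ dualSet (dualSet K)
dualSet-involutive K = K⊆ , ⊆K
  where
  K⊆ : K ⊆ dualSet (dualSet K)
  K⊆ {n , f} f∈K = (n , dualBF f) , ((n , f) , f∈K , refl) , cong (n ,_) (sym (dualBF-involutive f))
  ⊆K : dualSet (dualSet K) ⊆ K
  ⊆K (_ , ((n , f) , f∈K , refl) , refl) = subst (λ g → K (n , g)) (sym (dualBF-involutive f)) f∈K

dualBF-compose-dualBF : ∀ {n m} (f : BF (suc n)) (gs : Fin (suc n) → BF (suc m)) →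
                        dualBF (compose f (dualBF ∘ gs)) ≡ compose (dualBF f) gs
dualBF-compose-dualBF f gs =
  trans (dualBF-compose f (dualBF ∘ gs)) (compose-cong (dualBF f) (dualBF-involutive ∘ gs))

IsClonoid-resp-≐ : ∀ {C₁ C₂ K K′ : SetΩ} → K ≐ K′ → IsClonoid C₁ C₂ K′ → IsClonoid C₁ C₂ K
IsClonoid-resp-≐ (K⊆K′ , K′⊆K) (closedʳ , closedˡ) =
    (λ { (n , m , f , gs , f∈K , gs∈C₁ , eq) → K′⊆K (closedʳ (n , m , f , gs , K⊆K′ f∈K , gs∈C₁ , eq)) })
  , (λ { (n , m , f , gs , f∈C₂ , gs∈K , eq) → K′⊆K (closedˡ (n , m , f , gs , f∈C₂ , K⊆K′ ∘ gs∈K , eq)) })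

dualSet-IsClonoid : ∀ {A B L : SetΩ} → (∀ {h} → B h → A (dual h)) → IsClonoid Mc A L → IsClonoid Mc B (dualSet L)
dualSet-IsClonoid {A} {B} {L} B⇒A (closedʳ , closedˡ) = closedʳ′ , closedˡ′
  where
  closedʳ′ : (dualSet L · Mc) ⊆ dualSet L
  closedʳ′ (n , m , _ , gs , ((_ , f) , f∈L , refl) , gs∈Mc , refl) =
      (m , compose f (dualBF ∘ gs))
    , closedʳ (n , m , f , dualBF ∘ gs , f∈L , Mc-dual ∘ gs∈Mc , refl)
    , cong (m ,_) (sym (dualBF-compose-dualBF f gs))
  closedˡ′ : (B · dualSet L) ⊆ dualSet L
  closedˡ′ (n , m , f , gs , f∈B , gs∈L , refl) =
      (m , compose (dualBF f) (dualBF ∘ gs))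
    , closedˡ (n , m , dualBF f , dualBF ∘ gs , B⇒A f∈B , dualSet⁻ ∘ gs∈L , refl)
    , cong (m ,_) (sym (trans (dualBF-compose-dualBF (dualBF f) gs)
                              (cong (λ g → compose g gs) (dualBF-involutive f))))

Λc-clonoid⇔dual-of-Vc-clonoid : ∀ K → IsClonoid Mc Λc K ⇔ (Σ SetΩ λ L → IsClonoid Mc Vc L × (K ≐ dualSet L))
Λc-clonoid⇔dual-of-Vc-clonoid K = mk⇔
  (λ K-clonoid → dualSet K , dualSet-IsClonoid dual-Vc⊆Λc K-clonoid , dualSet-involutive K)
  (λ (L , L-clonoid , K≐dualL) → IsClonoid-resp-≐ {Mc} {Λc} K≐dualL (dualSet-IsClonoid dual-Λc⊆Vc L-clonoid))

proposition6p13 :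
    (Σ (Fin 56 → SetΩ) λ C →
        (∀ i → IsClonoid Mc Λc (C i))
      × (∀ i j → C i ≐ C j → i ≡ j)
      × (∀ K → IsClonoid Mc Λc K → ¬ ¬ (∃ λ i → K ≐ C i)))
    × (∀ K → IsClonoid Mc Λc K ⇔ (Σ SetΩ λ L → IsClonoid Mc Vc L × (K ≐ dualSet L)))
proposition6p13 =
    ( (λ i → ⟦ lookup validCodes i ⟧)
    , (λ i → ⟦⟧-IsClonoid (validCodes-valid i))
    , (λ i j ⟦i⟧≐⟦j⟧ → lookup-injective validCodes-unique i j (⟦⟧-injective ⟦i⟧≐⟦j⟧))
    , Λc-clonoid-listed )
  , Λc-clonoid⇔dual-of-Vc-clonoid
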